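{- Let $\mathcal{A}$ be a finite group, let $m\ge 1$ and $0\le k\le\lfloor m/2\rfloor$ be integers, and let $\alpha\in\mathrm{Aut}(\mathcal{A})$, $\sigma\in S_k$, $\tau\in S_{m-2k}$. Then for every subgroup $\mathcal{S}$ of $\mathcal{A}$ with $\alpha(\mathcal{S})=\mathcal{S}$, $$|\tilde F_{(\alpha,\sigma,\tau)}(m,k,\mathcal{S})|=\prod_{r=1}^{k}\prod_{s=0}^{j_r(\sigma)-1}\left(\frac{|\tilde F_{(\alpha,r)}(\mathcal{S})|+|\tilde I_{(\alpha,r)}(\mathcal{S})|}{2}-rs\right)\prod_{l=1}^{m-2k}\prod_{t=0}^{j_l(\tau)-1}\left(|\tilde F^o_{(\alpha,l)}(\mathcal{S})|-lt\right).$$ In particular, if $|\mathcal{A}|$ is odd, then $$|\tilde F_{(\alpha,\sigma,\tau)}(m,k,\mathcal{S})|=\begin{cases}\displaystyle\prod_{r=1}^{k}\prod_{s=0}^{j_r(\sigma)-1}\left(\frac{|\tilde F_{(\alpha,r)}(\mathcal{S})|+|\tilde I_{(\alpha,r)}(\mathcal{S})|}{2}-rs\right)&\text{if $m$ is even and }k=m/2,\\ 0&\text{otherwise.}\end{cases}$$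
   Context: $\mathcal{A}$ is a finite group with identity $e$; for $x\in\mathcal{A}$ let $\overline{x}=\{x,x^{ -1}\}$. For a subgroup $\mathcal{S}$ with $\alpha(\mathcal{S})=\mathcal{S}$, let $\tilde G_{m,k}(\mathcal{S})$ be the set of all $(m-k)$-tuples $(\overline{x_1},\dots,\overline{x_k},\overline{y_1},\dots,\overline{y_{m-2k}})$ of pairwise distinct terms with all $x_i,y_j\in\mathcal{S}$, $x_i^2\neq e$ and $y_j^{ -1}=y_j\neq e$. The group $\mathrm{Aut}(\mathcal{A})\times S_k\times S_{m-2k}$ acts on such tuples by $(\alpha,\sigma,\tau)\cdot(\overline{x_1},\dots,\overline{x_k},\overline{y_1},\dots,\overline{y_{m-2k}})=(\overline{\alpha(x_{\sigma^{ -1}(1)})},\dots,\overline{\alpha(x_{\sigma^{ -1}(k)})},\overline{\alpha(y_{\tau^{ -1}(1)})},\dots,\overline{\alpha(y_{\tau^{ -1}(m-2k)})})$, and $\tilde F_{(\alpha,\sigma,\tau)}(m,k,\mathcal{S})$ is the set of elements of $\tilde G_{m,k}(\mathcal{S})$ fixed by $(\alpha,\sigma,\tau)$. For a positive integer $n$: $\tilde F_{(\alpha,n)}(\mathcal{S})=\{g\in\mathcal{S}: g\neq g^{ -1},\ \alpha^n(g)=g,\ \alpha^l(g)\neq g \text{ and } \alpha^l(g)\neq g^{ -1} \text{ for } 1\le l<n\}$; $\tilde I_{(\alpha,n)}(\mathcal{S})=\{g\in\mathcal{S}: g\neq g^{ -1},\ \alpha^n(g)=g^{ -1},\ \alpha^l(g)\neq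 g \text{ and } \alpha^l(g)\neq g^{ -1} \text{ for } 1\le l<n\}$; $\tilde F^o_{(\alpha,n)}(\mathcal{S})=\{g\in\mathcal{S}: g^{ -1}=g\neq e,\ \alpha^n(g)=g,\ \alpha^l(g)\neq g \text{ for } 1\le l<n\}$. For a permutation $\sigma$, $j_r(\sigma)$ denotes the number of $r$-cycles in the disjoint cycle decomposition of $\sigma$ (fixed points count as 1-cycles). Empty products equal $1$. -}

module Defs where

open import Level using (0ℓ)
open import Function using (_∘_)
open import Data.Nat as ℕ using (ℕ; zero; suc; _≤_; _<_; _∸_; _+_; _*_; _≤?_; _<?_; s≤s; z≤n)
open import Data.Fin using (Fin; toℕ)
open import Data.Fin.Properties as FinP using (all?)
open import Data.Vec using (Vec; lookup; []; _∷_)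
open import Data.List as List using (List; length; filter; map; concatMap; allFin; cartesianProduct)
open import Data.Product using (Σ; ∃; _×_; _,_; proj₁; proj₂)
open import Data.Sum using (_⊎_; inj₁; inj₂)
import Data.Nat.Properties as NP
open import Data.Integer using (+_)
open import Data.Rational as ℚ using (ℚ)
open import Relation.Nullary using (¬_; Dec; yes; no)
open import Relation.Nullary.Decidable using (_×-dec_; _⊎-dec_; _→-dec_; ¬?)
open import Relation.Unary using (Pred; Decidable)
open import Relation.Binary.PropositionalEquality using (_≡_; _≢_; refl)
open import Algebra.Structures using (IsGroup)
open import Algebra.Bundles.Raw using (RawGroup)
open import Algebra.Morphism.Structures using (module GroupMorphisms)
open import Data.Fin.Permutation using (Permutation′; _⟨$⟩ʳ_; _⟨$⟩ˡ_)

iter : {A : Set} → (A → A) → ℕ → A → A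
iter f zero    x = x
iter f (suc n) x = f (iter f n x)

count : {A : Set} {P : Pred A 0ℓ} → Decidable P → List A → ℕ
count P? xs = length (filter P? xs)

allVec : (n k : ℕ) → List (Vec (Fin n) k)
allVec n zero    = [] List.∷ List.[]
allVec n (suc k) = concatMap (λ v → map (_∷ v) (allFin n)) (allVec n k)

∀<? : {P : ℕ → Set} → (∀ l → Dec (P l)) → ∀ n → Dec (∀ l → l < n → P l)
∀<? P? zero = yes (λ l ())
∀<? {P} P? (suc n) with ∀<? P? n | P? n
... | no ¬h | _ = no (λ h → ¬h (λ l l<n → h l (NP.m<n⇒m<1+n l<n)))
... | yes h | no ¬p = no (λ h' → ¬p (h' n NP.≤-refl))
... | yes h | yes p = yes aux
  where
  aux : ∀ l → l < suc n → P l
  aux l l<sn with NP.m≤n⇒m<n∨m≡n (NP.≤-pred l<sn)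
  ... | inj₁ l<n = h l l<n
  ... | inj₂ refl = p

prodℚ : ℕ → (ℕ → ℚ) → ℚ
prodℚ zero    f = ℚ.1ℚ
prodℚ (suc n) f = prodℚ n f ℚ.* f n

ℕ→ℚ : ℕ → ℚ
ℕ→ℚ n = (+ n) ℚ./ 1

-- Finite groups.  A finite group is represented (up to isomorphism)
-- by a group structure on Fin N, with propositional equality.

record FinGroup : Set where
  field
    N       : ℕ
    _·_     : Fin N → Fin N → Fin N
    e       : Fin N
    inv     : Fin N → Fin N
    isGroup : IsGroup _≡_ _·_ e inv

  rawGroup : RawGroup 0ℓ 0ℓ
  rawGroup = record { Carrier = Fin N ; _≈_ = _≡_ ; _∙_ = _·_ ; ε = e ; _⁻¹ = inv }

open FinGroup public

module _ (G : FinGroup) where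
  private
    A = Fin (N G)
    _∙_ = _·_ G
    e' = e G
    inv' = inv G

  Aut : Set
  Aut = Σ (A → A) (GroupMorphisms.IsGroupIsomorphism (rawGroup G) (rawGroup G))

  record IsSubgroup (S : Pred A 0ℓ) : Set where
    field
      e∈     : S e'
      ·-closed : ∀ {a b} → S a → S b → S (a ∙ b)
      inv-closed : ∀ {a} → S a → S (inv' a)

  Stable : Aut → Pred A 0ℓ → Set
  Stable (α , _) S = (∀ g → S g → S (α g)) × (∀ h → S h → ∃ λ g → S g × α g ≡ h)

  -- {a, a⁻¹} = {b, b⁻¹}
  BarEq : A → A → Set
  BarEq a b = a ≡ b ⊎ a ≡ inv' b

  barEq? : ∀ a b → Dec (BarEq a b)
  barEq? a b = (a FinP.≟ b) ⊎-dec (a FinP.≟ inv' b)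

  module _ (α : Aut) (S : Pred A 0ℓ) (S? : Decidable S) where
    private
      a = proj₁ α

    Ftil : ℕ → Pred A 0ℓ
    Ftil n g = S g × g ≢ inv' g × iter a n g ≡ g
             × (∀ l → l < n → 1 ≤ l → iter a l g ≢ g × iter a l g ≢ inv' g)

    Itil : ℕ → Pred A 0ℓ
    Itil n g = S g × g ≢ inv' g × iter a n g ≡ inv' g
             × (∀ l → l < n → 1 ≤ l → iter a l g ≢ g × iter a l g ≢ inv' g)

    Fotil : ℕ → Pred A 0ℓ
    Fotil n g = S g × inv' g ≡ g × g ≢ e' × iter a n g ≡ g
              × (∀ l → l < n → 1 ≤ l → iter a l g ≢ g)

    Ftil? : ∀ n → Decidable (Ftil n)
    Ftil? n g = S? g ×-dec ¬? (g FinP.≟ inv' g) ×-dec (iter a n g FinP.≟ g)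
      ×-dec ∀<? (λ l → (1 ≤? l) →-dec (¬? (iter a l g FinP.≟ g) ×-dec ¬? (iter a l g FinP.≟ inv' g))) n

    Itil? : ∀ n → Decidable (Itil n)
    Itil? n g = S? g ×-dec ¬? (g FinP.≟ inv' g) ×-dec (iter a n g FinP.≟ inv' g)
      ×-dec ∀<? (λ l → (1 ≤? l) →-dec (¬? (iter a l g FinP.≟ g) ×-dec ¬? (iter a l g FinP.≟ inv' g))) n

    Fotil? : ∀ n → Decidable (Fotil n)
    Fotil? n g = S? g ×-dec (inv' g FinP.≟ g) ×-dec ¬? (g FinP.≟ e') ×-dec (iter a n g FinP.≟ g)
      ×-dec ∀<? (λ l → (1 ≤? l) →-dec ¬? (iter a l g FinP.≟ g)) n

    #Ftil #Itil #Fotil : ℕ → ℕ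
    #Ftil n = count (Ftil? n) (allFin (N G))
    #Itil n = count (Itil? n) (allFin (N G))
    #Fotil n = count (Fotil? n) (allFin (N G))

    -- Elements of G̃_{m,k}(S): an (m-k)-tuple (x̄₁,…,x̄ₖ,ȳ₁,…,ȳ_{m-2k}).
    -- Each unordered pair x̄ = {x, x⁻¹} is encoded by its canonical
    -- representative, the one of x, x⁻¹ with the smaller index in Fin N.
    -- (For y with y = y⁻¹ the representative is y itself.)
    module _ (m k : ℕ) where
      InG : Pred (Vec A k × Vec A (m ∸ 2 * k)) 0ℓ
      InG (x , y) =
          (∀ i → toℕ (lookup x i) ≤ toℕ (inv' (lookup x i)))
        × (∀ i → S (lookup x i) × (lookup x i ∙ lookup x i) ≢ e')
        × (∀ j → S (lookup y j) × inv' (lookup y j) ≡ lookup y j × lookup y j ≢ e')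
        × (∀ i i' → i ≢ i' → ¬ BarEq (lookup x i) (lookup x i'))
        × (∀ j j' → j ≢ j' → ¬ BarEq (lookup y j) (lookup y j'))
        × (∀ i j → ¬ BarEq (lookup x i) (lookup y j))

      Fixed : Permutation′ k → Permutation′ (m ∸ 2 * k) → Pred (Vec A k × Vec A (m ∸ 2 * k)) 0ℓ
      Fixed σ τ (x , y) =
          (∀ i → BarEq (a (lookup x (σ ⟨$⟩ˡ i))) (lookup x i))
        × (∀ j → BarEq (a (lookup y (τ ⟨$⟩ˡ j))) (lookup y j))

      InG? : Decidable InG
      InG? (x , y) =
            all? (λ i → toℕ (lookup x i) ≤? toℕ (inv' (lookup x i)))
        ×-dec all? (λ i → S? (lookup x i) ×-dec ¬? ((lookup x i ∙ lookup x i) FinP.≟ e'))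
        ×-dec all? (λ j → S? (lookup y j) ×-dec (inv' (lookup y j) FinP.≟ lookup y j) ×-dec ¬? (lookup y j FinP.≟ e'))
        ×-dec all? (λ i → all? (λ i' → ¬? (i FinP.≟ i') →-dec ¬? (barEq? (lookup x i) (lookup x i'))))
        ×-dec all? (λ j → all? (λ j' → ¬? (j FinP.≟ j') →-dec ¬? (barEq? (lookup y j) (lookup y j'))))
        ×-dec all? (λ i → all? (λ j → ¬? (barEq? (lookup x i) (lookup y j))))

      Fixed? : ∀ σ τ → Decidable (Fixed σ τ)
      Fixed? σ τ (x , y) =
            all? (λ i → barEq? (a (lookup x (σ ⟨$⟩ˡ i))) (lookup x i))
        ×-dec all? (λ j → barEq? (a (lookup y (τ ⟨$⟩ˡ j))) (lookup y j))

      #Fix : Permutation′ k → Permutation′ (m ∸ 2 * k) → ℕ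
      #Fix σ τ = count (λ t → InG? t ×-dec Fixed? σ τ t)
                       (cartesianProduct (allVec (N G) k) (allVec (N G) (m ∸ 2 * k)))

-- j_r(σ): number of r-cycles of a permutation σ of Fin n, counted as the
-- number of points i lying in an r-cycle that are the least element
-- (w.r.t. the order of Fin n) of their cycle, i.e. one point per r-cycle.

module _ {n : ℕ} (σ : Permutation′ n) where
  private
    s = σ ⟨$⟩ʳ_

  CycleRep : ℕ → Pred (Fin n) 0ℓ
  CycleRep r i = iter s r i ≡ i
               × (∀ l → l < r → 1 ≤ l → iter s l i ≢ i)
               × (∀ l → l < r → toℕ i ≤ toℕ (iter s l i))

  CycleRep? : ∀ r → Decidable (CycleRep r)
  CycleRep? r i = (iter s r i FinP.≟ i)
    ×-dec ∀<? (λ l → (1 ≤? l) →-dec ¬? (iter s l i FinP.≟ i)) r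
    ×-dec ∀<? (λ l → toℕ i ≤? toℕ (iter s l i)) r

  j : ℕ → ℕ
  j r = count (CycleRep? r) (allFin n)

module _ (G : FinGroup) (α : Aut G) (S : Pred (Fin (N G)) 0ℓ) (S? : Decidable S) where

  ProdX : (k : ℕ) → Permutation′ k → ℚ
  ProdX k σ = prodℚ k (λ r′ → let r = suc r′ in
                prodℚ (j σ r) (λ s →
                  ((+ (#Ftil G α S S? r + #Itil G α S S? r)) ℚ./ 2) ℚ.- ℕ→ℚ (r * s)))

  ProdY : (n : ℕ) → Permutation′ n → ℚ
  ProdY n τ = prodℚ n (λ l′ → let l = suc l′ in
                prodℚ (j τ l) (λ t → ℕ→ℚ (#Fotil G α S S? l) ℚ.- ℕ→ℚ (l * t)))

-- A tuple fixed by (α, σ, τ) consists of an x-part and a y-part, which are counted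
-- independently.  Replacing each pair {x, x⁻¹} by its canonical representative, the
-- x-part becomes an injective map v from Fin k to the representatives of non-involutions
-- of S with β ∘ v = v ∘ σ, where β g is the representative of α g; the y-part is an
-- injective map v from Fin (m - 2k) to the involutions of S with α ∘ v = v ∘ τ.
-- Such an equivariant injection is built one cycle at a time: an r-cycle must be sent
-- onto an unused orbit of exact period r, and is determined by the image of one of its
-- points.  If c_r points have exact period r, the s-th r-cycle thus has c_r - r s
-- choices.  For representatives, inversion pairs off the elements of F̃_(α,r) ∪ Ĩ_(α,r),
-- so c_r = (|F̃_(α,r)| + |Ĩ_(α,r)|)/2.  If |A| is odd there are no involutions, since
-- right multiplication by one would pair off the elements of A.

module Submission where

open import Defs
open import Level using (0ℓ)
open import Function using (_∘_)
open import Data.Empty using (⊥-elim)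
open import Data.Unit using (tt)
open import Data.Product using (Σ; ∃; _×_; _,_; proj₁; proj₂)
open import Data.Sum using (_⊎_; inj₁; inj₂)
open import Data.Nat as ℕ using (ℕ; zero; suc; _≤_; _<_; _∸_; _+_; _*_; _≤?_; s≤s; z≤n)
import Data.Nat.Properties as ℕP
open import Data.Nat.DivMod using (_%_; _/_; m≡m%n+[m/n]*n; m%n<n)
open import Data.Nat.Divisibility using (_∣_; divides)
open import Data.Nat.Induction using (<-rec)
import Data.Integer as ℤ
import Data.Integer.Properties as ℤP
open import Data.Integer.Tactic.RingSolver using (solve-∀)
open import Data.Rational as ℚ using (ℚ)
import Data.Rational.Properties as ℚP
open import Data.Rational.Solver using (module +-*-Solver)
open import Data.Rational.Unnormalised as ℚᵘ using (mkℚᵘ; *≡*)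
import Data.Rational.Unnormalised.Properties as ℚᵘP
open import Data.Fin using (Fin; toℕ; fromℕ<)
import Data.Fin.Properties as FinP
open import Data.Fin.Permutation as Permutation using (Permutation′; _⟨$⟩ʳ_; _⟨$⟩ˡ_)
open import Data.Vec using (Vec; []; _∷_; lookup; tabulate; replicate)
import Data.Vec.Properties as VecP
open import Data.List as List using (List; length; filter; map; allFin; cartesianProduct; _++_)
import Data.List.Properties as ListP
open import Data.List.Membership.Propositional using (_∈_; lose)
open import Data.List.Membership.Propositional.Properties
  using (∈-filter⁺; ∈-filter⁻; ∈-allFin; ∈-map⁺; ∈-map⁻; ∈-concat⁺′; ∈-cartesianProduct⁺)
open import Data.List.Relation.Unary.Any using (here; there)
import Data.List.Relation.Unary.All as All
import Data.List.Relation.Unary.All.Properties as AllP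
import Data.List.Relation.Unary.AllPairs as AllPairs
import Data.List.Relation.Unary.AllPairs.Properties as AllPairsP
open import Data.List.Relation.Unary.Unique.Propositional using (Unique)
import Data.List.Relation.Unary.Unique.Propositional.Properties as UniqueP
open import Relation.Nullary using (¬_; Dec; yes; no)
import Relation.Nullary.Decidable as Dec
open import Relation.Nullary.Decidable using (_×-dec_; _⊎-dec_; _→-dec_; ¬?)
open import Relation.Unary using (Pred; Decidable; _≐_; _∩_; _∖_; U)
open import Relation.Unary.Properties using (_∩?_; ∁?; U?)
open import Relation.Binary using (tri<; tri≈; tri>; DecidableEquality)
open import Relation.Binary.PropositionalEquality using (_≡_; _≢_; refl; sym; trans; cong; cong₂; subst; module ≡-Reasoning)
open import Algebra.Bundles using (Group)
import Algebra.Properties.Group as GroupProperties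
open import Algebra.Structures using (IsGroup)
open import Algebra.Morphism.Structures using (module GroupMorphisms)

-- Counting in lists

module _ {A : Set} {P Q : Pred A 0ℓ} (P? : Decidable P) (Q? : Decidable Q) where

  count-cong : P ≐ Q → ∀ xs → count P? xs ≡ count Q? xs
  count-cong P≐Q xs = cong length (ListP.filter-≐ P? Q? P≐Q xs)

  count-split : ∀ xs → count P? xs ≡ count (P? ∩? Q?) xs + count (P? ∩? ∁? Q?) xs
  count-split List.[] = refl
  count-split (x List.∷ xs) with P? x | Q? x
  ... | yes _ | yes _ = cong suc (count-split xs)
  ... | yes _ | no _ = trans (cong suc (count-split xs)) (sym (ℕP.+-suc _ _))
  ... | no _ | _ = count-split xs

module _ {A : Set} {P : Pred A 0ℓ} (P? : Decidable P) where

  count-none : ∀ xs → (∀ x → ¬ P x) → count P? xs ≡ 0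
  count-none xs ¬P = cong length (ListP.filter-none P? (All.universal ¬P xs))

  count-universal : ∀ xs → (∀ x → P x) → count P? xs ≡ length xs
  count-universal xs p = cong length (ListP.filter-all P? (All.universal p xs))

  count-pos : ∀ {x} xs → x ∈ xs → P x → 1 ≤ count P? xs
  count-pos xs x∈xs px = ListP.filter-some P? (lose x∈xs px)

  count-witness : ∀ xs → count P? xs ≢ 0 → Σ A P
  count-witness List.[] n≢0 = ⊥-elim (n≢0 refl)
  count-witness (x List.∷ xs) n≢0 with P? x
  ... | yes px = x , px
  ... | no _ = count-witness xs n≢0

  count-++ : ∀ xs ys → count P? (xs ++ ys) ≡ count P? xs + count P? ys
  count-++ xs ys = trans (cong length (ListP.filter-++ P? xs ys)) (ListP.length-++ (filter P? xs))

  count-map : {B : Set} (f : B → A) → ∀ ys → count P? (map f ys) ≡ count (P? ∘ f) ys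
  count-map f List.[] = refl
  count-map f (y List.∷ ys) with P? (f y)
  ... | yes _ = cong suc (count-map f ys)
  ... | no _ = count-map f ys

module _ {A : Set} where

  remove : ∀ {x : A} (ys : List A) → x ∈ ys → List A
  remove (y List.∷ ys) (here _) = ys
  remove (y List.∷ ys) (there x∈ys) = y List.∷ remove ys x∈ys

  length-remove : ∀ {x : A} (ys : List A) (x∈ys : x ∈ ys) → length ys ≡ suc (length (remove ys x∈ys))
  length-remove (y List.∷ ys) (here _) = refl
  length-remove (y List.∷ ys) (there x∈ys) = cong suc (length-remove ys x∈ys)

  ∈-remove : ∀ {x z : A} (ys : List A) (x∈ys : x ∈ ys) → z ∈ ys → z ≢ x → z ∈ remove ys x∈ys
  ∈-remove (y List.∷ ys) (here refl) (here refl) z≢x = ⊥-elim (z≢x refl)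
  ∈-remove (y List.∷ ys) (here refl) (there z∈ys) z≢x = z∈ys
  ∈-remove (y List.∷ ys) (there x∈ys) (here z≡y) z≢x = here z≡y
  ∈-remove (y List.∷ ys) (there x∈ys) (there z∈ys) z≢x = there (∈-remove ys x∈ys z∈ys z≢x)

length-≤-injection : {A B : Set} (xs : List A) (ys : List B) (f : A → B) → Unique xs
  → (∀ {x} → x ∈ xs → f x ∈ ys) → (∀ {x y} → x ∈ xs → y ∈ xs → f x ≡ f y → x ≡ y)
  → length xs ≤ length ys
length-≤-injection List.[] ys f _ _ _ = z≤n
length-≤-injection (x List.∷ xs) ys f (x∉xs AllPairs.∷ unique) maps inj =
  subst (suc (length xs) ≤_) (sym (length-remove ys fx∈ys))
    (s≤s (length-≤-injection xs (remove ys fx∈ys) f unique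
      (λ z∈xs → ∈-remove ys fx∈ys (maps (there z∈xs))
         (λ fz≡fx → All.lookup x∉xs z∈xs (inj (here refl) (there z∈xs) (sym fz≡fx))))
      (λ z∈xs w∈xs → inj (there z∈xs) (there w∈xs))))
  where
  fx∈ys = maps (here refl)

module _ {A B : Set} {P : Pred A 0ℓ} {Q : Pred B 0ℓ} (P? : Decidable P) (Q? : Decidable Q) where

  count-≤-injection : (xs : List A) (ys : List B) → Unique xs → (∀ b → Q b → b ∈ ys)
    → (f : A → B) (g : B → A) → (∀ a → P a → Q (f a)) → (∀ a → P a → g (f a) ≡ a)
    → count P? xs ≤ count Q? ys
  count-≤-injection xs ys unique complete f g PQ gf =
    length-≤-injection (filter P? xs) (filter Q? ys) f (UniqueP.filter⁺ P? unique)
      (λ {a} a∈ → let Pa = proj₂ (∈-filter⁻ P? {xs = xs} a∈) in ∈-filter⁺ Q? (complete (f a) (PQ a Pa)) (PQ a Pa))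
      (λ {a} {a′} a∈ a′∈ fa≡fa′ → begin
          a        ≡⟨ gf a (proj₂ (∈-filter⁻ P? {xs = xs} a∈)) ⟨
          g (f a)  ≡⟨ cong g fa≡fa′ ⟩
          g (f a′) ≡⟨ gf a′ (proj₂ (∈-filter⁻ P? {xs = xs} a′∈)) ⟩
          a′       ∎)
    where open ≡-Reasoning

count-bijection : {A B : Set} {P : Pred A 0ℓ} {Q : Pred B 0ℓ} (P? : Decidable P) (Q? : Decidable Q)
  → (xs : List A) (ys : List B) → Unique xs → Unique ys
  → (∀ a → P a → a ∈ xs) → (∀ b → Q b → b ∈ ys)
  → (f : A → B) (g : B → A) → (∀ a → P a → Q (f a)) → (∀ b → Q b → P (g b))
  → (∀ a → P a → g (f a) ≡ a) → (∀ b → Q b → f (g b) ≡ b)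
  → count P? xs ≡ count Q? ys
count-bijection P? Q? xs ys uxs uys cxs cys f g PQ QP gf fg =
  ℕP.≤-antisym (count-≤-injection P? Q? xs ys uxs cys f g PQ gf)
               (count-≤-injection Q? P? ys xs uys cxs g f QP fg)

count-unique : {A : Set} {P : Pred A 0ℓ} (P? : Decidable P) (xs : List A) → Unique xs
  → (a : A) → P a → a ∈ xs → (∀ b → P b → b ≡ a) → count P? xs ≡ 1
count-unique P? xs unique a Pa a∈xs only-a =
  ℕP.≤-antisym
    (length-≤-injection (filter P? xs) (a List.∷ List.[]) (λ _ → a) (UniqueP.filter⁺ P? unique) (λ _ → here refl)
      (λ b∈ c∈ _ → trans (only-a _ (proj₂ (∈-filter⁻ P? {xs = xs} b∈))) (sym (only-a _ (proj₂ (∈-filter⁻ P? {xs = xs} c∈))))))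
    (count-pos P? xs a∈xs Pa)

lookup-≗⇒≡ : ∀ {A : Set} {n} {v w : Vec A n} → (∀ i → lookup v i ≡ lookup w i) → v ≡ w
lookup-≗⇒≡ {v = v} {w} v≗w = trans (sym (VecP.tabulate∘lookup v)) (trans (VecP.tabulate-cong v≗w) (VecP.tabulate∘lookup w))

allVec-complete : ∀ n k (v : Vec (Fin n) k) → v ∈ allVec n k
allVec-complete n zero [] = here refl
allVec-complete n (suc k) (x ∷ v) =
  ∈-concat⁺′ (∈-map⁺ (_∷ v) (∈-allFin x)) (∈-map⁺ (λ w → map (_∷ w) (allFin n)) (allVec-complete n k v))

allVec-unique : ∀ n k → Unique (allVec n k)
allVec-unique n zero = All.[] AllPairs.∷ AllPairs.[]
allVec-unique n (suc k) =
  UniqueP.concat⁺ (AllP.map⁺ (All.universal (λ _ → UniqueP.map⁺ VecP.∷-injectiveˡ (UniqueP.allFin⁺ n)) _))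
    (AllPairsP.map⁺ (AllPairs.map disjoint (allVec-unique n k)))
  where
  disjoint : ∀ {v w} → v ≢ w → ∀ {u} → ¬ (u ∈ map (_∷ v) (allFin n) × u ∈ map (_∷ w) (allFin n))
  disjoint v≢w (u∈v , u∈w) with ∈-map⁻ (_∷ _) u∈v | ∈-map⁻ (_∷ _) u∈w
  ... | _ , _ , refl | _ , _ , eq = v≢w (VecP.∷-injectiveʳ eq)

-- Rational products

toℚᵘ-ℕ→ℚ : ∀ n → ℚ.toℚᵘ (ℕ→ℚ n) ℚᵘ.≃ mkℚᵘ (ℤ.+ n) 0
toℚᵘ-ℕ→ℚ n = ℚP.toℚᵘ-fromℚᵘ (mkℚᵘ (ℤ.+ n) 0)

ℕ→ℚ-+ : ∀ a b → ℕ→ℚ (a ℕ.+ b) ≡ ℕ→ℚ a ℚ.+ ℕ→ℚ b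
ℕ→ℚ-+ a b = ℚP.toℚᵘ-injective (begin
  ℚ.toℚᵘ (ℕ→ℚ (a ℕ.+ b))                   ≈⟨ toℚᵘ-ℕ→ℚ (a ℕ.+ b) ⟩
  mkℚᵘ (ℤ.+ (a ℕ.+ b)) 0
    ≈⟨ *≡* (trans (cong (ℤ._* (ℤ.1ℤ ℤ.* ℤ.1ℤ)) (ℤP.pos-+ a b)) (cross-multiplied (ℤ.+ a) (ℤ.+ b))) ⟩
  mkℚᵘ (ℤ.+ a) 0 ℚᵘ.+ mkℚᵘ (ℤ.+ b) 0           ≈⟨ ℚᵘP.+-cong (toℚᵘ-ℕ→ℚ a) (toℚᵘ-ℕ→ℚ b) ⟨
  ℚ.toℚᵘ (ℕ→ℚ a) ℚᵘ.+ ℚ.toℚᵘ (ℕ→ℚ b)       ≈⟨ ℚP.toℚᵘ-homo-+ (ℕ→ℚ a) (ℕ→ℚ b) ⟨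
  ℚ.toℚᵘ (ℕ→ℚ a ℚ.+ ℕ→ℚ b)                 ∎)
  where
  open ℚᵘP.≃-Reasoning
  cross-multiplied : ∀ x y → (x ℤ.+ y) ℤ.* (ℤ.1ℤ ℤ.* ℤ.1ℤ) ≡ (x ℤ.* ℤ.1ℤ ℤ.+ y ℤ.* ℤ.1ℤ) ℤ.* ℤ.1ℤ
  cross-multiplied = solve-∀

half : ∀ c → (ℤ.+ (c ℕ.+ c)) ℚ./ 2 ≡ ℕ→ℚ c
half c = ℚP.toℚᵘ-injective (begin
  ℚ.toℚᵘ ((ℤ.+ (c ℕ.+ c)) ℚ./ 2)  ≈⟨ ℚP.toℚᵘ-fromℚᵘ (mkℚᵘ (ℤ.+ (c ℕ.+ c)) 1) ⟩
  mkℚᵘ (ℤ.+ (c ℕ.+ c)) 1          ≈⟨ *≡* (trans (cong (ℤ._* ℤ.1ℤ) (ℤP.pos-+ c c)) (cross-multiplied (ℤ.+ c))) ⟩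
  mkℚᵘ (ℤ.+ c) 0                  ≈⟨ toℚᵘ-ℕ→ℚ c ⟨
  ℚ.toℚᵘ (ℕ→ℚ c)                ∎)
  where
  open ℚᵘP.≃-Reasoning
  cross-multiplied : ∀ x → (x ℤ.+ x) ℤ.* ℤ.1ℤ ≡ x ℤ.* ℤ.+ 2
  cross-multiplied = solve-∀

prodℚ-cong : ∀ {n n′} {f g : ℕ → ℚ} → n ≡ n′ → (∀ i → i < n → f i ≡ g i) → prodℚ n f ≡ prodℚ n′ g
prodℚ-cong {zero} refl _ = refl
prodℚ-cong {suc n} refl f≡g = cong₂ ℚ._*_ (prodℚ-cong refl (λ i i<n → f≡g i (ℕP.m<n⇒m<1+n i<n))) (f≡g n ℕP.≤-refl)

prodℚ-suc : ∀ n (f : ℕ → ℚ) → prodℚ (suc n) f ≡ f 0 ℚ.* prodℚ n (f ∘ suc)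
prodℚ-suc zero f = trans (ℚP.*-identityˡ (f 0)) (sym (ℚP.*-identityʳ (f 0)))
prodℚ-suc (suc n) f = trans (cong (ℚ._* f (suc n)) (prodℚ-suc n f)) (ℚP.*-assoc (f 0) (prodℚ n (f ∘ suc)) (f (suc n)))

prodℚ-ones : ∀ n (f : ℕ → ℚ) → (∀ i → i < n → f i ≡ ℚ.1ℚ) → prodℚ n f ≡ ℚ.1ℚ
prodℚ-ones zero f _ = refl
prodℚ-ones (suc n) f f≡1 = cong₂ ℚ._*_ (prodℚ-ones n f (λ i i<n → f≡1 i (ℕP.m<n⇒m<1+n i<n))) (f≡1 n ℕP.≤-refl)

prodℚ-zero : ∀ n (f : ℕ → ℚ) p → p < n → f p ≡ ℚ.0ℚ → prodℚ n f ≡ ℚ.0ℚ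
prodℚ-zero (suc n) f p p<1+n fp≡0 with ℕP.m≤n⇒m<n∨m≡n (ℕP.≤-pred p<1+n)
... | inj₁ p<n = trans (cong (ℚ._* f n) (prodℚ-zero n f p p<n fp≡0)) (ℚP.*-zeroˡ (f n))
... | inj₂ refl = trans (cong (prodℚ n f ℚ.*_) fp≡0) (ℚP.*-zeroʳ (prodℚ n f))

prodℚ-scale : ∀ n (f g : ℕ → ℚ) a p → p < n → (∀ i → i < n → i ≢ p → f i ≡ g i) → f p ≡ a ℚ.* g p
  → prodℚ n f ≡ a ℚ.* prodℚ n g
prodℚ-scale (suc n) f g a p p<1+n f≡g fp≡ag with ℕP.m≤n⇒m<n∨m≡n (ℕP.≤-pred p<1+n)
... | inj₁ p<n = begin
  prodℚ n f ℚ.* f n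
    ≡⟨ cong₂ ℚ._*_ (prodℚ-scale n f g a p p<n (λ i i<n → f≡g i (ℕP.m<n⇒m<1+n i<n)) fp≡ag)
                   (f≡g n ℕP.≤-refl (λ n≡p → ℕP.<-irrefl (sym n≡p) p<n)) ⟩
  (a ℚ.* prodℚ n g) ℚ.* g n    ≡⟨ ℚP.*-assoc a (prodℚ n g) (g n) ⟩
  a ℚ.* (prodℚ n g ℚ.* g n)    ∎
  where open ≡-Reasoning
... | inj₂ refl = begin
  prodℚ n f ℚ.* f n
    ≡⟨ cong₂ ℚ._*_ (prodℚ-cong refl (λ i i<n → f≡g i (ℕP.m<n⇒m<1+n i<n) (λ i≡n → ℕP.<-irrefl i≡n i<n)))
                   fp≡ag ⟩
  prodℚ n g ℚ.* (a ℚ.* g n)    ≡⟨ ℚP.*-assoc (prodℚ n g) a (g n) ⟨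
  (prodℚ n g ℚ.* a) ℚ.* g n    ≡⟨ cong (ℚ._* g n) (ℚP.*-comm (prodℚ n g) a) ⟩
  (a ℚ.* prodℚ n g) ℚ.* g n    ≡⟨ ℚP.*-assoc a (prodℚ n g) (g n) ⟩
  a ℚ.* (prodℚ n g ℚ.* g n)    ∎
  where open ≡-Reasoning

fallingProduct : ℕ → ℕ → ℕ → ℚ
fallingProduct r c n = prodℚ n (λ t → ℕ→ℚ c ℚ.- ℕ→ℚ (r * t))

fallingProduct-0 : ∀ r n → fallingProduct r 0 (suc n) ≡ ℚ.0ℚ
fallingProduct-0 r n = prodℚ-zero (suc n) _ 0 (s≤s z≤n) (cong (λ z → ℚ.0ℚ ℚ.- ℕ→ℚ z) (ℕP.*-zeroʳ r))

fallingProduct-suc : ∀ r c n → fallingProduct r (r + c) (suc n) ≡ ℕ→ℚ (r + c) ℚ.* fallingProduct r c n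
fallingProduct-suc r c n = begin
  fallingProduct r (r + c) (suc n)
    ≡⟨ prodℚ-suc n _ ⟩
  (ℕ→ℚ (r + c) ℚ.- ℕ→ℚ (r * 0)) ℚ.* prodℚ n (λ t → ℕ→ℚ (r + c) ℚ.- ℕ→ℚ (r * suc t))
    ≡⟨ cong₂ ℚ._*_ first (prodℚ-cong {n} refl (λ t _ → shifted t)) ⟩
  ℕ→ℚ (r + c) ℚ.* fallingProduct r c n
    ∎
  where
  open ≡-Reasoning
  open +-*-Solver
  first : ℕ→ℚ (r + c) ℚ.- ℕ→ℚ (r * 0) ≡ ℕ→ℚ (r + c)
  first = trans (cong (λ z → ℕ→ℚ (r + c) ℚ.- ℕ→ℚ z) (ℕP.*-zeroʳ r)) (ℚP.+-identityʳ (ℕ→ℚ (r + c)))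
  shifted : ∀ t → ℕ→ℚ (r + c) ℚ.- ℕ→ℚ (r * suc t) ≡ ℕ→ℚ c ℚ.- ℕ→ℚ (r * t)
  shifted t = begin
    ℕ→ℚ (r + c) ℚ.- ℕ→ℚ (r * suc t)
      ≡⟨ cong₂ (λ x y → x ℚ.- y) (ℕ→ℚ-+ r c) (trans (cong ℕ→ℚ (ℕP.*-suc r t)) (ℕ→ℚ-+ r (r * t))) ⟩
    (ℕ→ℚ r ℚ.+ ℕ→ℚ c) ℚ.- (ℕ→ℚ r ℚ.+ ℕ→ℚ (r * t))
      ≡⟨ solve 3 (λ x y z → (x :+ y) :- (x :+ z) := y :- z) refl (ℕ→ℚ r) (ℕ→ℚ c) (ℕ→ℚ (r * t)) ⟩
    ℕ→ℚ c ℚ.- ℕ→ℚ (r * t)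
      ∎

cycleProduct : ℕ → (ℕ → ℕ) → (ℕ → ℕ) → ℚ
cycleProduct k c j = prodℚ k (λ p → fallingProduct (suc p) (c (suc p)) (j (suc p)))

cycleProduct-cong : ∀ k {c c′ j j′ : ℕ → ℕ}
  → (∀ q → c (suc q) ≡ c′ (suc q)) → (∀ q → j (suc q) ≡ j′ (suc q)) → cycleProduct k c j ≡ cycleProduct k c′ j′
cycleProduct-cong k c≡c′ j≡j′ = prodℚ-cong {k} refl (λ q _ → cong₂ (fallingProduct (suc q)) (c≡c′ q) (j≡j′ q))

cycleProduct-empty : ∀ k (c j : ℕ → ℕ) → (∀ r → j r ≡ 0) → cycleProduct k c j ≡ ℚ.1ℚ
cycleProduct-empty k c j j≡0 = prodℚ-ones k _ (λ p _ → cong (fallingProduct (suc p) (c (suc p))) (j≡0 (suc p)))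

cycleProduct-0 : ∀ k (c j : ℕ → ℕ) p → p < k → 1 ≤ j (suc p) → c (suc p) ≡ 0 → cycleProduct k c j ≡ ℚ.0ℚ
cycleProduct-0 k c j p p<k 1≤j c≡0 = prodℚ-zero k _ p p<k (begin
  fallingProduct (suc p) (c (suc p)) (j (suc p))
    ≡⟨ cong₂ (fallingProduct (suc p)) c≡0 (sym (ℕP.suc-pred _ ⦃ ℕ.>-nonZero 1≤j ⦄)) ⟩
  fallingProduct (suc p) 0 (suc (ℕ.pred (j (suc p))))
    ≡⟨ fallingProduct-0 (suc p) (ℕ.pred (j (suc p))) ⟩
  ℚ.0ℚ
    ∎)
  where open ≡-Reasoning

cycleProduct-peel : ∀ k (c j c′ j′ : ℕ → ℕ) p → p < k
  → j (suc p) ≡ suc (j′ (suc p)) → c (suc p) ≡ suc p + c′ (suc p)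
  → (∀ q → q ≢ p → c′ (suc q) ≡ c (suc q) × j′ (suc q) ≡ j (suc q))
  → cycleProduct k c j ≡ ℕ→ℚ (c (suc p)) ℚ.* cycleProduct k c′ j′
cycleProduct-peel k c j c′ j′ p p<k j≡ c≡ others = prodℚ-scale k _ _ (ℕ→ℚ (c (suc p))) p p<k
  (λ i _ i≢p → let (c′≡c , j′≡j) = others i i≢p
               in cong₂ (fallingProduct (suc i)) (sym c′≡c) (sym j′≡j))
  (begin
    fallingProduct (suc p) (c (suc p)) (j (suc p))
      ≡⟨ cong₂ (fallingProduct (suc p)) c≡ j≡ ⟩
    fallingProduct (suc p) (suc p + c′ (suc p)) (suc (j′ (suc p)))
      ≡⟨ fallingProduct-suc (suc p) (c′ (suc p)) (j′ (suc p)) ⟩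
    ℕ→ℚ (suc p + c′ (suc p)) ℚ.* fallingProduct (suc p) (c′ (suc p)) (j′ (suc p))
      ≡⟨ cong (λ z → ℕ→ℚ z ℚ.* fallingProduct (suc p) (c′ (suc p)) (j′ (suc p))) (sym c≡) ⟩
    ℕ→ℚ (c (suc p)) ℚ.* fallingProduct (suc p) (c′ (suc p)) (j′ (suc p))
      ∎)
  where open ≡-Reasoning

module _ {A B : Set} {P : Pred A 0ℓ} {Q : A → Pred B 0ℓ} (P? : Decidable P) (Q? : ∀ a → Decidable (Q a)) where

  count-cartesianProduct : ∀ xs ys q → (∀ a → P a → ℕ→ℚ (count (Q? a) ys) ≡ q)
    → ℕ→ℚ (count (λ ab → P? (proj₁ ab) ×-dec Q? (proj₁ ab) (proj₂ ab)) (cartesianProduct xs ys)) ≡ ℕ→ℚ (count P? xs) ℚ.* q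
  count-cartesianProduct List.[] ys q _ = sym (ℚP.*-zeroˡ q)
  count-cartesianProduct (x List.∷ xs) ys q fibre = begin
    ℕ→ℚ (count R? (map (x ,_) ys ++ cartesianProduct xs ys))
      ≡⟨ cong ℕ→ℚ (count-++ R? (map (x ,_) ys) _) ⟩
    ℕ→ℚ (count R? (map (x ,_) ys) + count R? (cartesianProduct xs ys))
      ≡⟨ ℕ→ℚ-+ (count R? (map (x ,_) ys)) _ ⟩
    ℕ→ℚ (count R? (map (x ,_) ys)) ℚ.+ ℕ→ℚ (count R? (cartesianProduct xs ys))
      ≡⟨ cong₂ ℚ._+_ (cong ℕ→ℚ (count-map R? (x ,_) ys)) (count-cartesianProduct xs ys q fibre) ⟩
    ℕ→ℚ (count (λ y → P? x ×-dec Q? x y) ys) ℚ.+ rest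
      ≡⟨ first-row ⟩
    ℕ→ℚ (count P? (x List.∷ xs)) ℚ.* q
      ∎
    where
    open ≡-Reasoning
    open +-*-Solver
    R? = λ ab → P? (proj₁ ab) ×-dec Q? (proj₁ ab) (proj₂ ab)
    rest = ℕ→ℚ (count P? xs) ℚ.* q
    first-row : ℕ→ℚ (count (λ y → P? x ×-dec Q? x y) ys) ℚ.+ rest ≡ ℕ→ℚ (count P? (x List.∷ xs)) ℚ.* q
    first-row with P? x
    ... | yes Px = begin
      ℕ→ℚ (count (λ y → yes Px ×-dec Q? x y) ys) ℚ.+ rest
        ≡⟨ cong (λ n → ℕ→ℚ n ℚ.+ rest) (count-cong _ (Q? x) (proj₂ , (Px ,_)) ys) ⟩
      ℕ→ℚ (count (Q? x) ys) ℚ.+ rest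
        ≡⟨ cong (ℚ._+ rest) (fibre x Px) ⟩
      q ℚ.+ ℕ→ℚ (count P? xs) ℚ.* q
        ≡⟨ solve 2 (λ n q → q :+ n :* q := (con ℚ.1ℚ :+ n) :* q) refl (ℕ→ℚ (count P? xs)) q ⟩
      (ℚ.1ℚ ℚ.+ ℕ→ℚ (count P? xs)) ℚ.* q
        ≡⟨ cong (ℚ._* q) (ℕ→ℚ-+ 1 (count P? xs)) ⟨
      ℕ→ℚ (suc (count P? xs)) ℚ.* q
        ∎
    ... | no ¬Px = begin
      ℕ→ℚ (count (λ y → no ¬Px ×-dec Q? x y) ys) ℚ.+ rest
        ≡⟨ cong (λ n → ℕ→ℚ n ℚ.+ rest) (count-none _ ys (λ _ → ¬Px ∘ proj₁)) ⟩
      ℚ.0ℚ ℚ.+ rest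
        ≡⟨ ℚP.+-identityˡ rest ⟩
      rest
        ∎

-- Iterates and orbits

least-witness : {P : ℕ → Set} → Decidable P → ∀ n → P n → ∃ λ m → P m × (∀ l → l < m → ¬ P l)
least-witness {P} P? = <-rec (λ n → P n → Least) search
  where
  Least = ∃ λ m → P m × (∀ l → l < m → ¬ P l)
  search : ∀ n → (∀ {l} → l < n → P l → Least) → P n → Least
  search n below Pn with ℕP.anyUpTo? P? n
  ... | yes (l , l<n , Pl) = below l<n Pl
  ... | no none = n , Pn , λ l l<n Pl → none (l , l<n , Pl)

module _ {A : Set} (f : A → A) where

  iter-+ : ∀ a b x → iter f (a + b) x ≡ iter f a (iter f b x)
  iter-+ zero b x = refl
  iter-+ (suc a) b x = cong f (iter-+ a b x)

  iter-comm : ∀ a b x → iter f a (iter f b x) ≡ iter f b (iter f a x)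
  iter-comm a b x = begin
    iter f a (iter f b x)  ≡⟨ iter-+ a b x ⟨
    iter f (a + b) x       ≡⟨ cong (λ n → iter f n x) (ℕP.+-comm a b) ⟩
    iter f (b + a) x       ≡⟨ iter-+ b a x ⟩
    iter f b (iter f a x)  ∎
    where open ≡-Reasoning

  iter-preserves : (P : Pred A 0ℓ) → (∀ x → P x → P (f x)) → ∀ a x → P x → P (iter f a x)
  iter-preserves P f-preserves zero x Px = Px
  iter-preserves P f-preserves (suc a) x Px = f-preserves _ (iter-preserves P f-preserves a x Px)

  iter-*-fixed : ∀ r x → iter f r x ≡ x → ∀ q → iter f (q * r) x ≡ x
  iter-*-fixed r x fixed zero = refl
  iter-*-fixed r x fixed (suc q) = trans (iter-+ r (q * r) x) (trans (cong (iter f r) (iter-*-fixed r x fixed q)) fixed)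

  iter-% : ∀ r .{{_ : ℕ.NonZero r}} x → iter f r x ≡ x → ∀ a → iter f a x ≡ iter f (a % r) x
  iter-% r x fixed a = begin
    iter f a x                                   ≡⟨ cong (λ n → iter f n x) (m≡m%n+[m/n]*n a r) ⟩
    iter f (a % r + (a / r) * r) x               ≡⟨ iter-+ (a % r) _ x ⟩
    iter f (a % r) (iter f ((a / r) * r) x)      ≡⟨ cong (iter f (a % r)) (iter-*-fixed r x fixed (a / r)) ⟩
    iter f (a % r) x                             ∎
    where open ≡-Reasoning

  MinimalPeriod : ℕ → A → Set
  MinimalPeriod r x = 1 ≤ r × iter f r x ≡ x × (∀ l → l < r → 1 ≤ l → iter f l x ≢ x)

  minimalPeriod? : DecidableEquality A → ∀ r → Decidable (MinimalPeriod r)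
  minimalPeriod? _≟_ r x = (1 ≤? r) ×-dec (iter f r x ≟ x) ×-dec ∀<? (λ l → (1 ≤? l) →-dec ¬? (iter f l x ≟ x)) r

  module _ {r x} (period : MinimalPeriod r x) where

    iter-return : ∀ l → l ≤ r → iter f (r ∸ l) (iter f l x) ≡ x
    iter-return l l≤r = trans (sym (iter-+ (r ∸ l) l x)) (trans (cong (λ n → iter f n x) (ℕP.m∸n+n≡m l≤r)) (proj₁ (proj₂ period)))

    private
      distinct< : ∀ l l′ → l < l′ → l′ < r → iter f l x ≢ iter f l′ x
      distinct< l l′ l<l′ l′<r fl≡fl′ = proj₂ (proj₂ period) (r ∸ l′ + l) bound positive returns
        where
        returns : iter f (r ∸ l′ + l) x ≡ x
        returns = trans (iter-+ (r ∸ l′) l x) (trans (cong (iter f (r ∸ l′)) fl≡fl′) (iter-return l′ (ℕP.<⇒≤ l′<r)))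
        bound : r ∸ l′ + l < r
        bound = subst (r ∸ l′ + l <_) (ℕP.m∸n+n≡m (ℕP.<⇒≤ l′<r)) (ℕP.+-monoʳ-< (r ∸ l′) l<l′)
        positive : 1 ≤ r ∸ l′ + l
        positive = ℕP.≤-trans (ℕP.m<n⇒0<n∸m l′<r) (ℕP.m≤m+n (r ∸ l′) l)

    iter-injective-index : ∀ l l′ → l < r → l′ < r → iter f l x ≡ iter f l′ x → l ≡ l′
    iter-injective-index l l′ l<r l′<r fl≡fl′ with ℕP.<-cmp l l′
    ... | tri≈ _ l≡l′ _ = l≡l′
    ... | tri< l<l′ _ _ = ⊥-elim (distinct< l l′ l<l′ l′<r fl≡fl′)
    ... | tri> _ _ l′<l = ⊥-elim (distinct< l′ l l′<l l<r (sym fl≡fl′))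

    minimalPeriod-iter : ∀ l → l < r → MinimalPeriod r (iter f l x)
    minimalPeriod-iter l l<r = proj₁ period , trans (iter-comm r l x) (cong (iter f l) (proj₁ (proj₂ period))) , aperiodic
      where
      aperiodic : ∀ l′ → l′ < r → 1 ≤ l′ → iter f l′ (iter f l x) ≢ iter f l x
      aperiodic l′ l′<r 1≤l′ eq = proj₂ (proj₂ period) l′ l′<r 1≤l′ (begin
        iter f l′ x                                  ≡⟨ cong (iter f l′) (iter-return l (ℕP.<⇒≤ l<r)) ⟨
        iter f l′ (iter f (r ∸ l) (iter f l x))      ≡⟨ iter-comm l′ (r ∸ l) (iter f l x) ⟩
        iter f (r ∸ l) (iter f l′ (iter f l x))      ≡⟨ cong (iter f (r ∸ l)) eq ⟩
        iter f (r ∸ l) (iter f l x)                  ≡⟨ iter-return l (ℕP.<⇒≤ l<r) ⟩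
        x                                            ∎)
        where open ≡-Reasoning

  minimalPeriod-unique : ∀ {r r′ x} → MinimalPeriod r x → MinimalPeriod r′ x → r ≡ r′
  minimalPeriod-unique {r} {r′} (1≤r , fixed , aperiodic) (1≤r′ , fixed′ , aperiodic′) with ℕP.<-cmp r r′
  ... | tri≈ _ r≡r′ _ = r≡r′
  ... | tri< r<r′ _ _ = ⊥-elim (aperiodic′ r r<r′ 1≤r fixed)
  ... | tri> _ _ r′<r = ⊥-elim (aperiodic r′ r′<r 1≤r′ fixed′)

  Orbit : ℕ → A → Pred A 0ℓ
  Orbit r x y = ∃ λ l → l < r × iter f l x ≡ y

  orbit? : DecidableEquality A → ∀ r x → Decidable (Orbit r x)
  orbit? _≟_ r x y = ℕP.anyUpTo? (λ l → iter f l x ≟ y) r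

  module _ {r x} (period : MinimalPeriod r x) where

    orbit-iter : ∀ a → Orbit r x (iter f a x)
    orbit-iter a = a % r , m%n<n a r , sym (iter-% r x (proj₁ (proj₂ period)) a)
      where instance _ = ℕ.>-nonZero (proj₁ period)

    orbit-f : ∀ {y} → Orbit r x y → Orbit r x (f y)
    orbit-f (l , _ , refl) = orbit-iter (suc l)

    orbit-minimalPeriod : ∀ {y} → Orbit r x y → MinimalPeriod r y
    orbit-minimalPeriod (l , l<r , refl) = minimalPeriod-iter period l l<r

    orbit-f⁻¹ : ∀ y → (∀ z → Orbit r x z → f y ≡ f z → y ≡ z) → Orbit r x (f y) → Orbit r x y
    orbit-f⁻¹ y f-injective (zero , _ , x≡fy) =
      r ∸ 1 , ℕP.∸-monoʳ-< (s≤s z≤n) (proj₁ period) , sym (f-injective _ (r ∸ 1 , ℕP.∸-monoʳ-< (s≤s z≤n) (proj₁ period) , refl) (begin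
        f y                      ≡⟨ x≡fy ⟨
        x                        ≡⟨ proj₁ (proj₂ period) ⟨
        iter f r x               ≡⟨ cong (λ n → iter f n x) (ℕP.suc-pred r ⦃ ℕ.>-nonZero (proj₁ period) ⦄) ⟨
        f (iter f (r ∸ 1) x)     ∎))
      where open ≡-Reasoning
    orbit-f⁻¹ y f-injective (suc l , 1+l<r , fl≡fy) =
      l , ℕP.<-trans (ℕP.n<1+n l) 1+l<r , sym (f-injective (iter f l x) (l , ℕP.<-trans (ℕP.n<1+n l) 1+l<r , refl) (sym fl≡fy))

  orbit-recentre : ∀ {r x} → MinimalPeriod r x → ∀ {y z} → Orbit r x y → Orbit r x z → Orbit r y z
  orbit-recentre {r} period {y} (a , a<r , refl) (l , l<r , refl) =
    subst (Orbit r y) (trans (iter-+ l (r ∸ a) y) (cong (iter f l) (iter-return period a (ℕP.<⇒≤ a<r))))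
      (orbit-iter (minimalPeriod-iter period a a<r) (l + (r ∸ a)))

module _ {k : ℕ} (f : Fin k → Fin k) (f-injective : ∀ a b → f a ≡ f b → a ≡ b) where

  iter-injective : ∀ n a b → iter f n a ≡ iter f n b → a ≡ b
  iter-injective zero a b eq = eq
  iter-injective (suc n) a b eq = iter-injective n a b (f-injective _ _ eq)

  minimalPeriod-exists : ∀ x → ∃ λ r → MinimalPeriod f r x
  minimalPeriod-exists x with FinP.pigeonhole (ℕP.n<1+n k) (λ (l : Fin (suc k)) → iter f (toℕ l) x)
  ... | i , j , i<j , fi≡fj with least-witness (λ p → iter f (suc p) x FinP.≟ x) (toℕ j ∸ toℕ i ∸ 1) returns
    where
    d = toℕ j ∸ toℕ i
    1≤d : 1 ≤ d
    1≤d = ℕP.m<n⇒0<n∸m i<j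
    returns : iter f (suc (d ∸ 1)) x ≡ x
    returns = begin
      iter f (suc (d ∸ 1)) x   ≡⟨ cong (λ n → iter f n x) (ℕP.m+[n∸m]≡n 1≤d) ⟩
      iter f d x               ≡⟨ iter-injective (toℕ i) (iter f d x) x (begin
                                     iter f (toℕ i) (iter f d x)  ≡⟨ iter-+ f (toℕ i) d x ⟨
                                     iter f (toℕ i + d) x
                                       ≡⟨ cong (λ n → iter f n x) (ℕP.m+[n∸m]≡n (ℕP.<⇒≤ i<j)) ⟩
                                     iter f (toℕ j) x             ≡⟨ fi≡fj ⟨
                                     iter f (toℕ i) x             ∎) ⟩
      x                        ∎
      where open ≡-Reasoning
  ... | p , fixed , below = suc p , s≤s z≤n , fixed , aperiodic
    where
    aperiodic : ∀ l → l < suc p → 1 ≤ l → iter f l x ≢ x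
    aperiodic (suc l) 1+l<1+p _ = below l (ℕP.≤-pred 1+l<1+p)

  minimalPeriod-≤ : ∀ {r x} → MinimalPeriod f r x → r ≤ k
  minimalPeriod-≤ {r} {x} period = FinP.injective⇒≤ {f = λ (l : Fin r) → iter f (toℕ l) x}
    (λ {a} {b} eq → FinP.toℕ-injective (iter-injective-index f period (toℕ a) (toℕ b) (FinP.toℕ<n a) (FinP.toℕ<n b) eq))

-- Equivariant injections

module EquivariantInjections (N : ℕ) (d₀ : Fin N) (β : Fin N → Fin N) {k : ℕ} (σ : Permutation′ k) where

  s : Fin k → Fin k
  s i = σ ⟨$⟩ʳ i

  s-injective : ∀ a b → s a ≡ s b → a ≡ b
  s-injective a b sa≡sb = trans (sym (Permutation.inverseˡ σ)) (trans (cong (σ ⟨$⟩ˡ_) sa≡sb) (Permutation.inverseˡ σ))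

  -- A vector stands for a map on D: off D it is padded with the dummy value d₀.
  record IsEmbedding (D : Pred (Fin k) 0ℓ) (X : Pred (Fin N) 0ℓ) (v : Vec (Fin N) k) : Set where
    field
      into        : ∀ i → D i → X (lookup v i)
      outside     : ∀ i → ¬ D i → lookup v i ≡ d₀
      equivariant : ∀ i → D i → β (lookup v i) ≡ lookup v (s i)
      injective   : ∀ i i′ → D i → D i′ → lookup v i ≡ lookup v i′ → i ≡ i′

  isEmbedding? : {D : Pred (Fin k) 0ℓ} {X : Pred (Fin N) 0ℓ} → Decidable D → Decidable X → Decidable (IsEmbedding D X)
  isEmbedding? D? X? v = Dec.map′ (λ (a , b , c , d) → record { into = a ; outside = b ; equivariant = c ; injective = d })
                                  (λ e → let open IsEmbedding e in into , outside , equivariant , injective)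
    (FinP.all? (λ i → D? i →-dec X? (lookup v i))
      ×-dec FinP.all? (λ i → ¬? (D? i) →-dec (lookup v i FinP.≟ d₀))
      ×-dec FinP.all? (λ i → D? i →-dec (β (lookup v i) FinP.≟ lookup v (s i)))
      ×-dec FinP.all? (λ i → FinP.all? (λ i′ → D? i →-dec (D? i′ →-dec ((lookup v i FinP.≟ lookup v i′) →-dec (i FinP.≟ i′))))))

  Periodic : Pred (Fin N) 0ℓ → ℕ → Pred (Fin N) 0ℓ
  Periodic X r = X ∩ MinimalPeriod β r

  periodic? : {X : Pred (Fin N) 0ℓ} → Decidable X → ∀ r → Decidable (Periodic X r)
  periodic? X? r = X? ∩? minimalPeriod? β FinP._≟_ r

  #periodic : {X : Pred (Fin N) 0ℓ} → Decidable X → ℕ → ℕ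
  #periodic X? r = count (periodic? X? r) (allFin N)

  #cycles : {D : Pred (Fin k) 0ℓ} → Decidable D → ℕ → ℕ
  #cycles D? r = count (CycleRep? σ r ∩? D?) (allFin k)

  #cycles-U : ∀ r → #cycles U? r ≡ j σ r
  #cycles-U r = count-cong (CycleRep? σ r ∩? U?) (CycleRep? σ r) (proj₁ , (_, _)) (allFin k)

  EmbeddingCount : ∀ {D X} → Decidable D → Decidable X → Set
  EmbeddingCount D? X? = ℕ→ℚ (count (isEmbedding? D? X?) (allVec N k)) ≡ cycleProduct k (#periodic X?) (#cycles D?)

  equivariant-iter : ∀ {D X v} → (∀ i → D i → D (s i)) → IsEmbedding D X v
    → ∀ a i → D i → iter β a (lookup v i) ≡ lookup v (iter s a i)
  equivariant-iter D-closed emb zero i Di = refl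
  equivariant-iter {D} D-closed emb (suc a) i Di =
    trans (cong β (equivariant-iter D-closed emb a i Di)) (IsEmbedding.equivariant emb (iter s a i) (iter-preserves s D D-closed a i Di))

  -- On the σ-cycle C of i₀ an embedding is determined by the image x of i₀, a point of
  -- exact β-period r; off C it is an embedding of D ∖ C avoiding the β-orbit of x.
  module RemoveCycle {D : Pred (Fin k) 0ℓ} {X : Pred (Fin N) 0ℓ} (D? : Decidable D) (X? : Decidable X)
                     (D-closed : ∀ i → D i → D (s i)) (X-closed : ∀ y → X y → X (β y))
                     (β-injective : ∀ a b → X a → X b → β a ≡ β b → a ≡ b)
                     {i₀ : Fin k} (D-i₀ : D i₀) (p : ℕ) (period : MinimalPeriod s (suc p) i₀) where

    r : ℕ
    r = suc p

    C : Pred (Fin k) 0ℓ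
    C = Orbit s r i₀

    C? : Decidable C
    C? = orbit? s FinP._≟_ r i₀

    D′ : Pred (Fin k) 0ℓ
    D′ = D ∖ C

    D′? : Decidable D′
    D′? = D? ∩? ∁? C?

    X′ : Fin N → Pred (Fin N) 0ℓ
    X′ x = X ∖ Orbit β r x

    X′? : ∀ x → Decidable (X′ x)
    X′? x = X? ∩? ∁? (orbit? β FinP._≟_ r x)

    C⊆D : ∀ {i} → C i → D i
    C⊆D (l , _ , refl) = iter-preserves s D D-closed l i₀ D-i₀

    s⁻¹-closed-C : ∀ {i} → C (s i) → C i
    s⁻¹-closed-C {i} = orbit-f⁻¹ s period i (λ z _ → s-injective i z)

    D′-closed : ∀ i → D′ i → D′ (s i)
    D′-closed i (Di , ¬Ci) = D-closed i Di , ¬Ci ∘ s⁻¹-closed-C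

    module _ {x : Fin N} (x-periodic : Periodic X r x) where

      X′-closed : ∀ y → X′ x y → X′ x (β y)
      X′-closed y (Xy , y∉orbit) = X-closed y Xy , y∉orbit ∘ orbit-f⁻¹ β (proj₂ x-periodic) y
        (λ { z (l , _ , refl) → β-injective y z Xy (iter-preserves β X X-closed l x (proj₁ x-periodic)) })

      X′-injective : ∀ a b → X′ x a → X′ x b → β a ≡ β b → a ≡ b
      X′-injective a b X′a X′b = β-injective a b (proj₁ X′a) (proj₁ X′b)

    extend : Fin N → Vec (Fin N) k → Fin k → Fin N
    extend x v′ i with C? i
    ... | yes (l , _ , _) = iter β l x
    ... | no _ = lookup v′ i

    reset : Vec (Fin N) k → Fin k → Fin N
    reset v i with C? i
    ... | yes _ = d₀
    ... | no _ = lookup v i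

    extend-orbit : ∀ x v′ a → MinimalPeriod β r x → extend x v′ (iter s a i₀) ≡ iter β a x
    extend-orbit x v′ a x-period with C? (iter s a i₀)
    ... | yes (l , l<r , sˡi₀≡sᵃi₀) = begin
      iter β l x        ≡⟨ cong (λ n → iter β n x) (iter-injective-index s period l (a % r) l<r (m%n<n a r)
                             (trans sˡi₀≡sᵃi₀ (iter-% s r i₀ (proj₁ (proj₂ period)) a))) ⟩
      iter β (a % r) x  ≡⟨ iter-% β r x (proj₁ (proj₂ x-period)) a ⟨
      iter β a x        ∎
      where open ≡-Reasoning
    ... | no ¬C = ⊥-elim (¬C (orbit-iter s period a))

    extend-outside : ∀ x v′ i → ¬ C i → extend x v′ i ≡ lookup v′ i
    extend-outside x v′ i ¬Ci with C? i
    ... | yes Ci = ⊥-elim (¬Ci Ci)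
    ... | no _ = refl

    reset-inside : ∀ v i → C i → reset v i ≡ d₀
    reset-inside v i Ci with C? i
    ... | yes _ = refl
    ... | no ¬Ci = ⊥-elim (¬Ci Ci)

    reset-outside : ∀ v i → ¬ C i → reset v i ≡ lookup v i
    reset-outside v i ¬Ci with C? i
    ... | yes Ci = ⊥-elim (¬Ci Ci)
    ... | no _ = refl

    detach : Vec (Fin N) k → Fin N × Vec (Fin N) k
    detach v = lookup v i₀ , tabulate (reset v)

    attach : Fin N × Vec (Fin N) k → Vec (Fin N) k
    attach (x , v′) = tabulate (extend x v′)

    Pieces : Pred (Fin N × Vec (Fin N) k) 0ℓ
    Pieces (x , v′) = Periodic X r x × IsEmbedding D′ (X′ x) v′

    pieces? : Decidable Pieces
    pieces? (x , v′) = periodic? X? r x ×-dec isEmbedding? D′? (X′? x) v′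

    detach-pieces : ∀ v → IsEmbedding D X v → Pieces (detach v)
    detach-pieces v emb = x-periodic , record
      { into        = λ i (Di , ¬Ci) → subst (X′ x) (sym (kept i ¬Ci)) (into i Di , ¬Ci ∘ pull-back i Di)
      ; outside     = outside′
      ; equivariant = λ i (Di , ¬Ci) → trans (cong β (kept i ¬Ci))
                        (trans (equivariant i Di) (sym (kept (s i) (¬Ci ∘ s⁻¹-closed-C))))
      ; injective   = λ i i′ (Di , ¬Ci) (Di′ , ¬Ci′) eq → injective i i′ Di Di′ (trans (sym (kept i ¬Ci)) (trans eq (kept i′ ¬Ci′)))
      }
      where
      open IsEmbedding emb
      x = lookup v i₀
      orbit-image : ∀ a → iter β a x ≡ lookup v (iter s a i₀)
      orbit-image a = equivariant-iter D-closed emb a i₀ D-i₀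
      x-periodic : Periodic X r x
      x-periodic = into i₀ D-i₀ , s≤s z≤n , trans (orbit-image r) (cong (lookup v) (proj₁ (proj₂ period))) ,
        λ l l<r 1≤l βˡx≡x → proj₂ (proj₂ period) l l<r 1≤l
          (injective _ _ (iter-preserves s D D-closed l i₀ D-i₀) D-i₀ (trans (sym (orbit-image l)) βˡx≡x))
      pull-back : ∀ i → D i → Orbit β r x (lookup v i) → C i
      pull-back i Di (l , l<r , βˡx≡vi) =
        l , l<r , injective _ _ (iter-preserves s D D-closed l i₀ D-i₀) Di (trans (sym (orbit-image l)) βˡx≡vi)
      kept : ∀ i → ¬ C i → lookup (tabulate (reset v)) i ≡ lookup v i
      kept i ¬Ci = trans (VecP.lookup∘tabulate (reset v) i) (reset-outside v i ¬Ci)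
      outside′ : ∀ i → ¬ D′ i → lookup (tabulate (reset v)) i ≡ d₀
      outside′ i ¬D′i with C? i
      ... | yes Ci = trans (VecP.lookup∘tabulate (reset v) i) (reset-inside v i Ci)
      ... | no ¬Ci = trans (kept i ¬Ci) (outside i (λ Di → ¬D′i (Di , ¬Ci)))

    attach-embedding : ∀ xv → Pieces xv → IsEmbedding D X (attach xv)
    attach-embedding (x , v′) ((Xx , x-period) , emb′) = record
      { into = into′ ; outside = outside′ ; equivariant = equivariant′ ; injective = injective′ }
      where
      open IsEmbedding emb′
      w = tabulate (extend x v′)
      kept : ∀ i → ¬ C i → lookup w i ≡ lookup v′ i
      kept i ¬Ci = trans (VecP.lookup∘tabulate (extend x v′) i) (extend-outside x v′ i ¬Ci)
      on-orbit : ∀ a → lookup w (iter s a i₀) ≡ iter β a x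
      on-orbit a = trans (VecP.lookup∘tabulate (extend x v′) (iter s a i₀)) (extend-orbit x v′ a x-period)
      into′ : ∀ i → D i → X (lookup w i)
      into′ i Di with C? i
      ... | yes (l , _ , refl) = subst X (sym (on-orbit l)) (iter-preserves β X X-closed l x Xx)
      ... | no ¬Ci = subst X (sym (kept i ¬Ci)) (proj₁ (into i (Di , ¬Ci)))
      outside′ : ∀ i → ¬ D i → lookup w i ≡ d₀
      outside′ i ¬Di = trans (kept i (¬Di ∘ C⊆D)) (outside i (¬Di ∘ proj₁))
      equivariant′ : ∀ i → D i → β (lookup w i) ≡ lookup w (s i)
      equivariant′ i Di with C? i
      ... | yes (l , _ , refl) = trans (cong β (on-orbit l)) (sym (on-orbit (suc l)))
      ... | no ¬Ci = trans (cong β (kept i ¬Ci)) (trans (equivariant i (Di , ¬Ci)) (sym (kept (s i) (¬Ci ∘ s⁻¹-closed-C))))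
      injective′ : ∀ i i′ → D i → D i′ → lookup w i ≡ lookup w i′ → i ≡ i′
      injective′ i i′ Di Di′ eq with C? i | C? i′
      ... | yes (l , l<r , refl) | yes (l′ , l′<r , refl) =
            cong (λ n → iter s n i₀) (iter-injective-index β x-period l l′ l<r l′<r (trans (sym (on-orbit l)) (trans eq (on-orbit l′))))
      ... | yes (l , l<r , refl) | no ¬Ci′ =
            ⊥-elim (proj₂ (into i′ (Di′ , ¬Ci′)) (l , l<r , trans (sym (on-orbit l)) (trans eq (kept i′ ¬Ci′))))
      ... | no ¬Ci | yes (l′ , l′<r , refl) =
            ⊥-elim (proj₂ (into i (Di , ¬Ci)) (l′ , l′<r , trans (sym (on-orbit l′)) (trans (sym eq) (kept i ¬Ci))))
      ... | no ¬Ci | no ¬Ci′ = injective i i′ (Di , ¬Ci) (Di′ , ¬Ci′) (trans (sym (kept i ¬Ci)) (trans eq (kept i′ ¬Ci′)))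

    attach∘detach : ∀ v → IsEmbedding D X v → attach (detach v) ≡ v
    attach∘detach v emb = lookup-≗⇒≡ pointwise
      where
      pointwise : ∀ i → lookup (attach (detach v)) i ≡ lookup v i
      pointwise i with C? i
      ... | yes (l , l<r , refl) = begin
        lookup (attach (detach v)) (iter s l i₀)         ≡⟨ VecP.lookup∘tabulate _ (iter s l i₀) ⟩
        extend (lookup v i₀) (tabulate (reset v)) (iter s l i₀) ≡⟨ extend-orbit _ _ l (proj₂ (proj₁ (detach-pieces v emb))) ⟩
        iter β l (lookup v i₀)                           ≡⟨ equivariant-iter D-closed emb l i₀ D-i₀ ⟩
        lookup v (iter s l i₀)                           ∎
        where open ≡-Reasoning
      ... | no ¬Ci = begin
        lookup (attach (detach v)) i                     ≡⟨ VecP.lookup∘tabulate _ i ⟩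
        extend (lookup v i₀) (tabulate (reset v)) i      ≡⟨ extend-outside _ _ i ¬Ci ⟩
        lookup (tabulate (reset v)) i                    ≡⟨ VecP.lookup∘tabulate _ i ⟩
        reset v i                                        ≡⟨ reset-outside v i ¬Ci ⟩
        lookup v i                                       ∎
        where open ≡-Reasoning

    detach∘attach : ∀ xv → Pieces xv → detach (attach xv) ≡ xv
    detach∘attach (x , v′) ((_ , x-period) , emb′) =
      cong₂ _,_ (trans (VecP.lookup∘tabulate (extend x v′) i₀) (extend-orbit x v′ 0 x-period)) (lookup-≗⇒≡ pointwise)
      where
      pointwise : ∀ i → lookup (tabulate (reset (attach (x , v′)))) i ≡ lookup v′ i
      pointwise i with C? i
      ... | yes Ci = trans (VecP.lookup∘tabulate _ i)
                       (trans (reset-inside _ i Ci) (sym (IsEmbedding.outside emb′ i (λ D′i → proj₂ D′i Ci))))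
      ... | no ¬Ci = trans (VecP.lookup∘tabulate _ i) (trans (reset-outside _ i ¬Ci)
                       (trans (VecP.lookup∘tabulate _ i) (extend-outside x v′ i ¬Ci)))

    count-detach : count (isEmbedding? D? X?) (allVec N k) ≡ count pieces? (cartesianProduct (allFin N) (allVec N k))
    count-detach = count-bijection (isEmbedding? D? X?) pieces? (allVec N k) (cartesianProduct (allFin N) (allVec N k))
      (allVec-unique N k) (UniqueP.cartesianProduct⁺ (UniqueP.allFin⁺ N) (allVec-unique N k))
      (λ v _ → allVec-complete N k v)
      (λ (x , v′) _ → ∈-cartesianProduct⁺ (∈-allFin x) (allVec-complete N k v′))
      detach attach detach-pieces attach-embedding attach∘detach detach∘attach

    module _ {x : Fin N} (x-periodic : Periodic X r x) where

      private
        x-orbit? = orbit? β FinP._≟_ r x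

      count-periodic-orbit-≢ : ∀ r′ → r′ ≢ r → count (periodic? X? r′ ∩? x-orbit?) (allFin N) ≡ 0
      count-periodic-orbit-≢ r′ r′≢r = count-none _ (allFin N) λ y ((_ , y-period) , y-in-orbit) →
        r′≢r (minimalPeriod-unique β y-period (orbit-minimalPeriod β (proj₂ x-periodic) y-in-orbit))

      count-periodic-orbit : count (periodic? X? r ∩? x-orbit?) (allFin N) ≡ r
      count-periodic-orbit = begin
        count (periodic? X? r ∩? x-orbit?) (allFin N)
          ≡⟨ count-bijection U? (periodic? X? r ∩? x-orbit?) (allFin r) (allFin N)
               (UniqueP.allFin⁺ r) (UniqueP.allFin⁺ N) (λ l _ → ∈-allFin l) (λ y _ → ∈-allFin y)
               walk index (λ l _ → walk-lands l) (λ _ _ → tt)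
               (λ l _ → index-walk l) (λ y (_ , y-in-orbit) → walk-index y y-in-orbit) ⟨
        count U? (allFin r)
          ≡⟨ count-universal U? (allFin r) _ ⟩
        length (allFin r)
          ≡⟨ ListP.length-tabulate (λ i → i) ⟩
        r
          ∎
        where
        open ≡-Reasoning
        walk : Fin r → Fin N
        walk l = iter β (toℕ l) x
        index : Fin N → Fin r
        index y with x-orbit? y
        ... | yes (l , l<r , _) = fromℕ< l<r
        ... | no _ = Fin.zero
          where import Data.Fin as Fin
        walk-lands : ∀ l → Periodic X r (walk l) × Orbit β r x (walk l)
        walk-lands l =
          ( iter-preserves β X X-closed (toℕ l) x (proj₁ x-periodic)
          , minimalPeriod-iter β (proj₂ x-periodic) (toℕ l) (FinP.toℕ<n l) )
          , (toℕ l , FinP.toℕ<n l , refl)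
        index-walk : ∀ l → index (walk l) ≡ l
        index-walk l with x-orbit? (walk l)
        ... | yes (l′ , l′<r , eq) = FinP.toℕ-injective (trans (FinP.toℕ-fromℕ< l′<r)
                                       (iter-injective-index β (proj₂ x-periodic) l′ (toℕ l) l′<r (FinP.toℕ<n l) eq))
        ... | no ∉orbit = ⊥-elim (∉orbit (toℕ l , FinP.toℕ<n l , refl))
        walk-index : ∀ y → Orbit β r x y → walk (index y) ≡ y
        walk-index y y-in-orbit with x-orbit? y
        ... | yes (l , l<r , eq) = trans (cong (λ n → iter β n x) (FinP.toℕ-fromℕ< l<r)) eq
        ... | no ∉orbit = ⊥-elim (∉orbit y-in-orbit)

      #periodic-split : ∀ r′ → #periodic X? r′ ≡ count (periodic? X? r′ ∩? x-orbit?) (allFin N) + #periodic (X′? x) r′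
      #periodic-split r′ = trans (count-split (periodic? X? r′) x-orbit? (allFin N))
        (cong (count (periodic? X? r′ ∩? x-orbit?) (allFin N) +_)
          (count-cong _ (periodic? (X′? x) r′) ((λ ((Xy , y-period) , ∉orbit) → (Xy , ∉orbit) , y-period)
                                                , (λ ((Xy , ∉orbit) , y-period) → (Xy , y-period) , ∉orbit)) (allFin N)))

    private
      CR→period : ∀ r′ i → 1 ≤ r′ → CycleRep σ r′ i → MinimalPeriod s r′ i
      CR→period r′ i 1≤r′ (fixed , aperiodic , _) = 1≤r′ , fixed , aperiodic

    count-cycleRep-orbit-≢ : ∀ r′ → 1 ≤ r′ → r′ ≢ r → count ((CycleRep? σ r′ ∩? D?) ∩? C?) (allFin k) ≡ 0
    count-cycleRep-orbit-≢ r′ 1≤r′ r′≢r = count-none _ (allFin k) λ i ((i-rep , _) , Ci) →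
      r′≢r (minimalPeriod-unique s (CR→period r′ i 1≤r′ i-rep) (orbit-minimalPeriod s period Ci))

    -- The cycle representative of C in the sense of CycleRep is its element of least index.
    private
      HitsIndex : ℕ → Set
      HitsIndex n = ∃ λ l → l < r × toℕ (iter s l i₀) ≡ n

      least-index : ∃ λ n → HitsIndex n × (∀ n′ → n′ < n → ¬ HitsIndex n′)
      least-index = least-witness (λ n → ℕP.anyUpTo? (λ l → toℕ (iter s l i₀) ℕ.≟ n) r) (toℕ i₀) (0 , s≤s z≤n , refl)

      lₘ : ℕ
      lₘ = proj₁ (proj₁ (proj₂ least-index))

      lₘ<r : lₘ < r
      lₘ<r = proj₁ (proj₂ (proj₁ (proj₂ least-index)))

      m : Fin k
      m = iter s lₘ i₀

      m-least : ∀ {y} → C y → toℕ m ≤ toℕ y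
      m-least (l , l<r , refl) with least-index
      ... | n , (_ , _ , toℕm≡n) , below = subst (_≤ toℕ (iter s l i₀)) (sym toℕm≡n)
        (ℕP.≮⇒≥ (λ lt → below _ lt (l , l<r , refl)))

      m-rep : CycleRep σ r m
      m-rep = fixed , aperiodic , λ l _ → m-least (subst C (iter-+ s l lₘ i₀) (orbit-iter s period (l + lₘ)))
        where
        m-period = minimalPeriod-iter s period lₘ lₘ<r
        fixed = proj₁ (proj₂ m-period)
        aperiodic = proj₂ (proj₂ m-period)

    count-cycleRep-orbit : count ((CycleRep? σ r ∩? D?) ∩? C?) (allFin k) ≡ 1
    count-cycleRep-orbit = count-unique _ (allFin k) (UniqueP.allFin⁺ k) m ((m-rep , C⊆D m∈C) , m∈C) (∈-allFin m) only-m
      where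
      m∈C : C m
      m∈C = lₘ , lₘ<r , refl
      only-m : ∀ y → (CycleRep σ r y × D y) × C y → y ≡ m
      only-m y ((y-rep , _) , y∈C) with orbit-recentre s period y∈C m∈C
      ... | l , l<r , sˡy≡m = FinP.toℕ-injective (ℕP.≤-antisym
        (subst (λ z → toℕ y ≤ toℕ z) sˡy≡m (proj₂ (proj₂ y-rep) l l<r)) (m-least y∈C))

    #cycles-split : ∀ r′ → #cycles D? r′ ≡ count ((CycleRep? σ r′ ∩? D?) ∩? C?) (allFin k) + #cycles D′? r′
    #cycles-split r′ = trans (count-split (CycleRep? σ r′ ∩? D?) C? (allFin k))
      (cong (count ((CycleRep? σ r′ ∩? D?) ∩? C?) (allFin k) +_)
        (count-cong _ (CycleRep? σ r′ ∩? D′?) ((λ ((rep , Di) , ¬Ci) → rep , Di , ¬Ci) , (λ (rep , Di , ¬Ci) → (rep , Di) , ¬Ci)) (allFin k)))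

    cycle-exists : 1 ≤ #cycles D? r
    cycle-exists = count-pos _ (allFin k) (∈-allFin m) (m-rep , C⊆D (lₘ , lₘ<r , refl))

    D′-smaller : count D′? (allFin k) < count D? (allFin k)
    D′-smaller = subst (count D′? (allFin k) <_) (sym (count-split D? C? (allFin k)))
      (ℕP.+-monoˡ-≤ (count D′? (allFin k)) (count-pos (D? ∩? C?) (allFin k) (∈-allFin i₀) (D-i₀ , 0 , s≤s z≤n , refl)))

    count-embeddings-unperiodic : #periodic X? r ≡ 0 → count (isEmbedding? D? X?) (allVec N k) ≡ 0
    count-embeddings-unperiodic none = count-none _ (allVec N k) λ v emb → ℕP.<-irrefl (sym none)
      (count-pos (periodic? X? r) (allFin N) (∈-allFin _) (proj₁ (detach-pieces v emb)))

    count-embeddings-peel : (∀ x → Periodic X r x → EmbeddingCount D′? (X′? x))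
      → ∀ {x₀} → Periodic X r x₀ → EmbeddingCount D? X?
    count-embeddings-peel count-smaller {x₀} x₀-periodic = begin
      ℕ→ℚ (count (isEmbedding? D? X?) (allVec N k))
        ≡⟨ cong ℕ→ℚ count-detach ⟩
      ℕ→ℚ (count pieces? (cartesianProduct (allFin N) (allVec N k)))
        ≡⟨ count-cartesianProduct (periodic? X? r) (λ x → isEmbedding? D′? (X′? x)) (allFin N) (allVec N k)
             (cycleProduct k (#periodic (X′? x₀)) (#cycles D′?))
             (λ x x-periodic → trans (count-smaller x x-periodic)
                (cycleProduct-cong k {#periodic (X′? x)} {#periodic (X′? x₀)} {#cycles D′?} {#cycles D′?}
                   (#periodic-X′-invariant x-periodic ∘ suc) (λ _ → refl))) ⟩
      ℕ→ℚ (#periodic X? r) ℚ.* cycleProduct k (#periodic (X′? x₀)) (#cycles D′?)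
        ≡⟨ cycleProduct-peel k (#periodic X?) (#cycles D?) (#periodic (X′? x₀)) (#cycles D′?) p
             (minimalPeriod-≤ s s-injective period) #cycles-r #periodic-r others ⟨
      cycleProduct k (#periodic X?) (#cycles D?)
        ∎
      where
      open ≡-Reasoning
      orbit-count : Fin N → ℕ → ℕ
      orbit-count x r′ = count (periodic? X? r′ ∩? orbit? β FinP._≟_ r x) (allFin N)
      orbit-count-invariant : ∀ {x} → Periodic X r x → ∀ r′ → orbit-count x r′ ≡ orbit-count x₀ r′
      orbit-count-invariant x-periodic r′ = by-cases (r′ ℕ.≟ r)
        where
        by-cases : Dec (r′ ≡ r) → orbit-count _ r′ ≡ orbit-count x₀ r′
        by-cases (yes refl) = trans (count-periodic-orbit x-periodic) (sym (count-periodic-orbit x₀-periodic))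
        by-cases (no r′≢r) = trans (count-periodic-orbit-≢ x-periodic r′ r′≢r) (sym (count-periodic-orbit-≢ x₀-periodic r′ r′≢r))
      #periodic-X′-invariant : ∀ {x} → Periodic X r x → ∀ r′ → #periodic (X′? x) r′ ≡ #periodic (X′? x₀) r′
      #periodic-X′-invariant {x} x-periodic r′ =
        ℕP.+-cancelˡ-≡ (orbit-count x₀ r′) (#periodic (X′? x) r′) (#periodic (X′? x₀) r′) (begin
          orbit-count x₀ r′ + #periodic (X′? x) r′
            ≡⟨ cong (_+ #periodic (X′? x) r′) (orbit-count-invariant x-periodic r′) ⟨
          orbit-count x r′ + #periodic (X′? x) r′    ≡⟨ #periodic-split x-periodic r′ ⟨
          #periodic X? r′                            ≡⟨ #periodic-split x₀-periodic r′ ⟩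
          orbit-count x₀ r′ + #periodic (X′? x₀) r′  ∎)
      #cycles-r : #cycles D? r ≡ suc (#cycles D′? r)
      #cycles-r = trans (#cycles-split r) (cong (_+ #cycles D′? r) count-cycleRep-orbit)
      #periodic-r : #periodic X? r ≡ r + #periodic (X′? x₀) r
      #periodic-r = trans (#periodic-split x₀-periodic r) (cong (_+ #periodic (X′? x₀) r) (count-periodic-orbit x₀-periodic))
      others : ∀ q → q ≢ p → #periodic (X′? x₀) (suc q) ≡ #periodic X? (suc q) × #cycles D′? (suc q) ≡ #cycles D? (suc q)
      others q q≢p =
        sym (trans (#periodic-split x₀-periodic (suc q))
                   (cong (_+ #periodic (X′? x₀) (suc q)) (count-periodic-orbit-≢ x₀-periodic (suc q) 1+q≢r))) ,
        sym (trans (#cycles-split (suc q))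
                   (cong (_+ #cycles D′? (suc q)) (count-cycleRep-orbit-≢ (suc q) (s≤s z≤n) 1+q≢r)))
        where
        1+q≢r : suc q ≢ r
        1+q≢r = q≢p ∘ ℕP.suc-injective

  count-embeddings-∅ : ∀ {D X} (D? : Decidable D) (X? : Decidable X) → (∀ i → ¬ D i) → EmbeddingCount D? X?
  count-embeddings-∅ {D} {X} D? X? empty = begin
    ℕ→ℚ (count (isEmbedding? D? X?) (allVec N k))
      ≡⟨ cong ℕ→ℚ (count-unique (isEmbedding? D? X?) (allVec N k) (allVec-unique N k) (replicate k d₀)
                                                        constant (allVec-complete N k _) only-constant) ⟩
    ℚ.1ℚ
      ≡⟨ cycleProduct-empty k (#periodic X?) (#cycles D?) (λ r → count-none (CycleRep? σ r ∩? D?) (allFin k) (λ i → empty i ∘ proj₂)) ⟨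
    cycleProduct k (#periodic X?) (#cycles D?)     ∎
    where
    open ≡-Reasoning
    constant : IsEmbedding D X (replicate k d₀)
    constant = record
      { into = λ i Di → ⊥-elim (empty i Di) ; outside = λ i _ → VecP.lookup-replicate i d₀
      ; equivariant = λ i Di → ⊥-elim (empty i Di) ; injective = λ i _ Di → ⊥-elim (empty i Di) }
    only-constant : ∀ v → IsEmbedding D X v → v ≡ replicate k d₀
    only-constant v emb = lookup-≗⇒≡ λ i → trans (IsEmbedding.outside emb i (empty i)) (sym (VecP.lookup-replicate i d₀))

  count-embeddings : ∀ {D X} (D? : Decidable D) (X? : Decidable X)
    → (∀ i → D i → D (s i)) → (∀ y → X y → X (β y)) → (∀ a b → X a → X b → β a ≡ β b → a ≡ b)
    → EmbeddingCount D? X?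
  count-embeddings D? = <-rec Claim induct _ D? refl
    where
    Claim : ℕ → Set₁
    Claim n = ∀ {D X} (D? : Decidable D) → count D? (allFin k) ≡ n → (X? : Decidable X)
      → (∀ i → D i → D (s i)) → (∀ y → X y → X (β y)) → (∀ a b → X a → X b → β a ≡ β b → a ≡ b)
      → EmbeddingCount D? X?
    induct : ∀ n → (∀ {n′} → n′ < n → Claim n′) → Claim n
    induct n smaller {D} D? refl X? D-closed X-closed β-injective = by-emptiness (FinP.any? D?)
      where
      by-emptiness : Dec (∃ D) → EmbeddingCount D? X?
      by-emptiness (no ∄D) = count-embeddings-∅ D? X? (λ i Di → ∄D (i , Di))
      by-emptiness (yes (i₀ , D-i₀)) = by-period (minimalPeriod-exists s s-injective i₀)
        where
        by-period : (∃ λ r → MinimalPeriod s r i₀) → EmbeddingCount D? X?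
        by-period (zero , period) = ⊥-elim (ℕP.<-irrefl refl (proj₁ period))
        by-period (suc p , period) = by-periodic-points (#periodic X? r ℕ.≟ 0)
          where
          open RemoveCycle D? X? D-closed X-closed β-injective D-i₀ p period
          by-periodic-points : Dec (#periodic X? r ≡ 0) → EmbeddingCount D? X?
          by-periodic-points (yes none) =
            trans (cong ℕ→ℚ (count-embeddings-unperiodic none))
                  (sym (cycleProduct-0 k (#periodic X?) (#cycles D?) p (minimalPeriod-≤ s s-injective period) cycle-exists none))
          by-periodic-points (no some) = count-embeddings-peel
            (λ x x-periodic → smaller D′-smaller D′? refl (X′? x) D′-closed (X′-closed x-periodic) (X′-injective x-periodic))
            (proj₂ (count-witness (periodic? X? r) (allFin N) some))

-- Pairs {g, g⁻¹} and their representatives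

Below : ∀ {M} → (Fin M → Fin M) → Pred (Fin M) 0ℓ
Below ι y = toℕ y ≤ toℕ (ι y)

below? : ∀ {M} (ι : Fin M → Fin M) → Decidable (Below ι)
below? ι y = toℕ y ≤? toℕ (ι y)

count-involution-pairs : ∀ {M} (ι : Fin M → Fin M) {P : Pred (Fin M) 0ℓ} (P? : Decidable P)
  → (∀ y → P y → P (ι y)) → (∀ y → P y → ι (ι y) ≡ y) → (∀ y → P y → y ≢ ι y)
  → count P? (allFin M) ≡ count (P? ∩? below? ι) (allFin M) + count (P? ∩? below? ι) (allFin M)
count-involution-pairs {M} ι P? P-closed ι-involutive no-fixed-point =
  trans (count-split P? (below? ι) (allFin M)) (cong (count (P? ∩? below? ι) (allFin M) +_)
    (count-bijection (P? ∩? ∁? (below? ι)) (P? ∩? below? ι) (allFin M) (allFin M)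
      (UniqueP.allFin⁺ M) (UniqueP.allFin⁺ M) (λ y _ → ∈-allFin y) (λ y _ → ∈-allFin y) ι ι
      (λ y (Py , ¬below) → P-closed y Py , subst (λ z → toℕ (ι y) ≤ toℕ z) (sym (ι-involutive y Py)) (ℕP.<⇒≤ (ℕP.≰⇒> ¬below)))
      (λ y (Py , below) → P-closed y Py , λ ιy-below → no-fixed-point y Py
        (FinP.toℕ-injective (ℕP.≤-antisym below (subst (λ z → toℕ (ι y) ≤ toℕ z) (ι-involutive y Py) ιy-below))))
      (λ y (Py , _) → ι-involutive y Py) (λ y (Py , _) → ι-involutive y Py)))

module Representatives (G : FinGroup) where

  private
    A = Fin (N G)
    _∙_ = _·_ G
    ε = e G
    _⁻¹ : A → A
    _⁻¹ = inv G

  group : Group 0ℓ 0ℓ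
  group = record { isGroup = isGroup G }

  open GroupProperties group public using (⁻¹-involutive; ⁻¹-injective; inverseʳ-unique; ∙-cancelˡ)
  open IsGroup (isGroup G) using (inverseʳ)

  square≡ε⇒self-inverse : ∀ g → g ∙ g ≡ ε → g ⁻¹ ≡ g
  square≡ε⇒self-inverse g g²≡ε = sym (inverseʳ-unique g g g²≡ε)

  self-inverse⇒square≡ε : ∀ g → g ⁻¹ ≡ g → g ∙ g ≡ ε
  self-inverse⇒square≡ε g g⁻¹≡g = trans (cong (g ∙_) (sym g⁻¹≡g)) (inverseʳ g)

  Canonical : Pred A 0ℓ
  Canonical = Below _⁻¹

  rep : A → A
  rep y with toℕ y ≤? toℕ (y ⁻¹)
  ... | yes _ = y
  ... | no _ = y ⁻¹

  rep-cases : ∀ y → rep y ≡ y ⊎ rep y ≡ y ⁻¹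
  rep-cases y with toℕ y ≤? toℕ (y ⁻¹)
  ... | yes _ = inj₁ refl
  ... | no _ = inj₂ refl

  rep-canonical : ∀ y → Canonical (rep y)
  rep-canonical y with toℕ y ≤? toℕ (y ⁻¹)
  ... | yes y-below = y-below
  ... | no ¬y-below = subst (λ z → toℕ (y ⁻¹) ≤ toℕ z) (sym (⁻¹-involutive y)) (ℕP.<⇒≤ (ℕP.≰⇒> ¬y-below))

  rep-canonical-id : ∀ y → Canonical y → rep y ≡ y
  rep-canonical-id y y-below with toℕ y ≤? toℕ (y ⁻¹)
  ... | yes _ = refl
  ... | no ¬y-below = ⊥-elim (¬y-below y-below)

  rep-⁻¹ : ∀ y → rep (y ⁻¹) ≡ rep y
  rep-⁻¹ y with toℕ (y ⁻¹) ≤? toℕ (y ⁻¹ ⁻¹) | toℕ y ≤? toℕ (y ⁻¹)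
  ... | yes b₁ | yes b₂ = FinP.toℕ-injective (ℕP.≤-antisym (subst (λ z → toℕ (y ⁻¹) ≤ toℕ z) (⁻¹-involutive y) b₁) b₂)
  ... | yes _  | no _   = refl
  ... | no _   | yes _  = ⁻¹-involutive y
  ... | no ¬b₁ | no ¬b₂ = ⊥-elim (¬b₂ (ℕP.<⇒≤ (subst (λ z → toℕ z < toℕ (y ⁻¹)) (⁻¹-involutive y) (ℕP.≰⇒> ¬b₁))))

  canonical-BarEq⇒≡ : ∀ x y → Canonical x → Canonical y → BarEq G x y → x ≡ y
  canonical-BarEq⇒≡ x y _ _ (inj₁ x≡y) = x≡y
  canonical-BarEq⇒≡ x y x-below y-below (inj₂ x≡y⁻¹) = FinP.toℕ-injective (ℕP.≤-antisym
    (subst (λ z → toℕ x ≤ toℕ z) (trans (cong _⁻¹ x≡y⁻¹) (⁻¹-involutive y)) x-below)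
    (subst (λ z → toℕ y ≤ toℕ z) (sym x≡y⁻¹) y-below))

  BarEq⇒rep≡ : ∀ x y → Canonical y → BarEq G x y → rep x ≡ y
  BarEq⇒rep≡ x y y-below (inj₁ refl) = rep-canonical-id x y-below
  BarEq⇒rep≡ x y y-below (inj₂ refl) = trans (rep-⁻¹ y) (rep-canonical-id y y-below)

  rep≡⇒BarEq : ∀ x y → rep x ≡ rep y → BarEq G x y
  rep≡⇒BarEq x y rx≡ry with rep-cases x | rep-cases y
  ... | inj₁ rx≡x   | inj₁ ry≡y   = inj₁ (trans (sym rx≡x) (trans rx≡ry ry≡y))
  ... | inj₁ rx≡x   | inj₂ ry≡y⁻¹ = inj₂ (trans (sym rx≡x) (trans rx≡ry ry≡y⁻¹))
  ... | inj₂ rx≡x⁻¹ | inj₁ ry≡y   = inj₂ (trans (sym (⁻¹-involutive x)) (cong _⁻¹ (trans (sym rx≡x⁻¹) (trans rx≡ry ry≡y))))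
  ... | inj₂ rx≡x⁻¹ | inj₂ ry≡y⁻¹ = inj₁ (⁻¹-injective (trans (sym rx≡x⁻¹) (trans rx≡ry ry≡y⁻¹)))

  rep-BarEq : ∀ x → BarEq G x (rep x)
  rep-BarEq x = rep≡⇒BarEq x (rep x) (sym (rep-canonical-id (rep x) (rep-canonical x)))

  NonInvolution : Pred A 0ℓ
  NonInvolution y = y ≢ y ⁻¹

  square≢ε⇒nonInvolution : ∀ y → y ∙ y ≢ ε → NonInvolution y
  square≢ε⇒nonInvolution y y²≢ε y≡y⁻¹ = y²≢ε (self-inverse⇒square≡ε y (sym y≡y⁻¹))

  nonInvolution⇒square≢ε : ∀ y → NonInvolution y → y ∙ y ≢ ε
  nonInvolution⇒square≢ε y y≢y⁻¹ y²≡ε = y≢y⁻¹ (sym (square≡ε⇒self-inverse y y²≡ε))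

  nonInvolution-⁻¹ : ∀ y → NonInvolution y → NonInvolution (y ⁻¹)
  nonInvolution-⁻¹ y y≢y⁻¹ y⁻¹≡y⁻¹⁻¹ = y≢y⁻¹ (sym (trans y⁻¹≡y⁻¹⁻¹ (⁻¹-involutive y)))

  nonInvolution-rep : ∀ y → NonInvolution y → NonInvolution (rep y)
  nonInvolution-rep y y-nonInv with rep-cases y
  ... | inj₁ ry≡y   = subst NonInvolution (sym ry≡y) y-nonInv
  ... | inj₂ ry≡y⁻¹ = subst NonInvolution (sym ry≡y⁻¹) (nonInvolution-⁻¹ y y-nonInv)

  module _ (α : Aut G) where

    private
      a = proj₁ α
      module a = GroupMorphisms.IsGroupIsomorphism (proj₂ α)

    iter-⁻¹ : ∀ l x → iter a l (x ⁻¹) ≡ iter a l x ⁻¹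
    iter-⁻¹ zero x = refl
    iter-⁻¹ (suc l) x = trans (cong a (iter-⁻¹ l x)) (a.⁻¹-homo (iter a l x))

    β : A → A
    β y = rep (a y)

    rep-a-rep : ∀ z → rep (a (rep z)) ≡ rep (a z)
    rep-a-rep z with rep-cases z
    ... | inj₁ rz≡z   = cong (rep ∘ a) rz≡z
    ... | inj₂ rz≡z⁻¹ = trans (cong (rep ∘ a) rz≡z⁻¹) (trans (cong rep (a.⁻¹-homo z)) (rep-⁻¹ (a z)))

    iter-β : ∀ y → Canonical y → ∀ l → iter β l y ≡ rep (iter a l y)
    iter-β y y-canonical zero = sym (rep-canonical-id y y-canonical)
    iter-β y y-canonical (suc l) = trans (cong β (iter-β y y-canonical l)) (rep-a-rep (iter a l y))

    iter-β-fixed⇒BarEq : ∀ y → Canonical y → ∀ l → iter β l y ≡ y → BarEq G (iter a l y) y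
    iter-β-fixed⇒BarEq y y-canonical l fixed =
      rep≡⇒BarEq (iter a l y) y (trans (sym (iter-β y y-canonical l)) (trans fixed (sym (rep-canonical-id y y-canonical))))

    BarEq⇒iter-β-fixed : ∀ y → Canonical y → ∀ l → BarEq G (iter a l y) y → iter β l y ≡ y
    BarEq⇒iter-β-fixed y y-canonical l bar = trans (iter-β y y-canonical l) (BarEq⇒rep≡ (iter a l y) y y-canonical bar)

involution⇒even-order : (G : FinGroup) → ∀ g → inv G g ≡ g → g ≢ e G → 2 ∣ N G
involution⇒even-order G g g⁻¹≡g g≢ε = divides (count lower (allFin (N G))) (begin
  N G                                                             ≡⟨ ListP.length-tabulate (λ i → i) ⟨
  length (allFin (N G))                                           ≡⟨ count-universal U? (allFin (N G)) _ ⟨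
  count U? (allFin (N G))
    ≡⟨ count-involution-pairs (_∙ g) U? (λ _ _ → _) (λ h _ → ∙g-involutive h) (λ h _ → h≢h∙g h) ⟩
  count lower (allFin (N G)) + count lower (allFin (N G))
    ≡⟨ cong (count lower (allFin (N G)) +_) (ℕP.+-identityʳ (count lower (allFin (N G)))) ⟨
  2 * count lower (allFin (N G))                                  ≡⟨ ℕP.*-comm 2 (count lower (allFin (N G))) ⟩
  count lower (allFin (N G)) * 2                                  ∎)
  where
  open ≡-Reasoning
  open Representatives G using (self-inverse⇒square≡ε; ∙-cancelˡ)
  open IsGroup (isGroup G) using (assoc; identityʳ)
  _∙_ = _·_ G
  lower = U? ∩? below? (_∙ g)
  ∙g-involutive : ∀ h → (h ∙ g) ∙ g ≡ h
  ∙g-involutive h = trans (assoc h g g) (trans (cong (h ∙_) (self-inverse⇒square≡ε g g⁻¹≡g)) (identityʳ h))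
  h≢h∙g : ∀ h → h ≢ h ∙ g
  h≢h∙g h h≡h∙g = g≢ε (sym (∙-cancelˡ h (e G) g (trans (identityʳ h) h≡h∙g)))

-- Fixed tuples as pairs of equivariant injections

module FixedTuples (G : FinGroup) (α : Aut G) (S : Pred (Fin (N G)) 0ℓ) (S? : Decidable S)
                (S-subgroup : IsSubgroup G S) (S-stable : Stable G α S) where

  open Representatives G
  private
    A = Fin (N G)
    _∙_ = _·_ G
    ε = e G
    _⁻¹ : A → A
    _⁻¹ = inv G
    a = proj₁ α
    module a = GroupMorphisms.IsGroupIsomorphism (proj₂ α)

  S-⁻¹ : ∀ {y} → S y → S (y ⁻¹)
  S-⁻¹ = IsSubgroup.inv-closed S-subgroup

  S-a : ∀ y → S y → S (a y)
  S-a = proj₁ S-stable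

  S-rep : ∀ y → S y → S (rep y)
  S-rep y Sy with rep-cases y
  ... | inj₁ ry≡y   = subst S (sym ry≡y) Sy
  ... | inj₂ ry≡y⁻¹ = subst S (sym ry≡y⁻¹) (S-⁻¹ Sy)

  PairReps : Pred A 0ℓ
  PairReps y = S y × y ∙ y ≢ ε × Canonical y

  pairReps? : Decidable PairReps
  pairReps? y = S? y ×-dec ¬? ((y ∙ y) FinP.≟ ε) ×-dec below? _⁻¹ y

  β-closed-PairReps : ∀ y → PairReps y → PairReps (β α y)
  β-closed-PairReps y (Sy , y²≢ε , _) =
    S-rep (a y) (S-a y Sy) ,
    nonInvolution⇒square≢ε (β α y) (nonInvolution-rep (a y) (a-nonInvolution (square≢ε⇒nonInvolution y y²≢ε))) ,
    rep-canonical (a y)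
    where
    a-nonInvolution : ∀ {z} → NonInvolution z → NonInvolution (a z)
    a-nonInvolution {z} z≢z⁻¹ az≡az⁻¹ = z≢z⁻¹ (a.injective (trans az≡az⁻¹ (sym (a.⁻¹-homo z))))

  β-injective-PairReps : ∀ x y → PairReps x → PairReps y → β α x ≡ β α y → x ≡ y
  β-injective-PairReps x y (_ , _ , x-canonical) (_ , _ , y-canonical) βx≡βy =
    canonical-BarEq⇒≡ x y x-canonical y-canonical (a-reflects-BarEq (rep≡⇒BarEq (a x) (a y) βx≡βy))
    where
    a-reflects-BarEq : BarEq G (a x) (a y) → BarEq G x y
    a-reflects-BarEq (inj₁ ax≡ay) = inj₁ (a.injective ax≡ay)
    a-reflects-BarEq (inj₂ ax≡ay⁻¹) = inj₂ (a.injective (trans ax≡ay⁻¹ (sym (a.⁻¹-homo y))))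

  Involutions : Pred A 0ℓ
  Involutions y = S y × y ⁻¹ ≡ y × y ≢ ε

  involutions? : Decidable Involutions
  involutions? y = S? y ×-dec ((y ⁻¹) FinP.≟ y) ×-dec ¬? (y FinP.≟ ε)

  a-closed-Involutions : ∀ y → Involutions y → Involutions (a y)
  a-closed-Involutions y (Sy , y⁻¹≡y , y≢ε) =
    S-a y Sy , trans (sym (a.⁻¹-homo y)) (cong a y⁻¹≡y) , λ ay≡ε → y≢ε (a.injective (trans ay≡ε (sym a.ε-homo)))

  FixedOrInverted : ℕ → Pred A 0ℓ
  FixedOrInverted r y = Ftil G α S S? r y ⊎ Itil G α S S? r y

  fixedOrInverted? : ∀ r → Decidable (FixedOrInverted r)
  fixedOrInverted? r y = Ftil? G α S S? r y ⊎-dec Itil? G α S S? r y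

  count-fixedOrInverted : ∀ r → count (fixedOrInverted? r) (allFin (N G)) ≡ #Ftil G α S S? r + #Itil G α S S? r
  count-fixedOrInverted r = trans (count-split (fixedOrInverted? r) (Ftil? G α S S? r) (allFin (N G)))
    (cong₂ _+_ (count-cong (fixedOrInverted? r ∩? Ftil? G α S S? r) (Ftil? G α S S? r) (proj₂ , λ F → inj₁ F , F) (allFin (N G)))
               (count-cong (fixedOrInverted? r ∩? ∁? (Ftil? G α S S? r)) (Itil? G α S S? r)
                           (only-inverted , λ I → inj₂ I , not-fixed I) (allFin (N G))))
    where
    only-inverted : ∀ {y} → FixedOrInverted r y × ¬ Ftil G α S S? r y → Itil G α S S? r y
    only-inverted (inj₁ F , ¬F) = ⊥-elim (¬F F)
    only-inverted (inj₂ I , _) = I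
    not-fixed : ∀ {y} → Itil G α S S? r y → ¬ Ftil G α S S? r y
    not-fixed (_ , y≢y⁻¹ , aʳy≡y⁻¹ , _) (_ , _ , aʳy≡y , _) = y≢y⁻¹ (trans (sym aʳy≡y) aʳy≡y⁻¹)

  PairAperiodic : ℕ → Pred A 0ℓ
  PairAperiodic r y = ∀ l → l < r → 1 ≤ l → iter a l y ≢ y × iter a l y ≢ y ⁻¹

  pairAperiodic-⁻¹ : ∀ {r y} → PairAperiodic r y → PairAperiodic r (y ⁻¹)
  pairAperiodic-⁻¹ {y = y} aperiodic l l<r 1≤l =
      (λ aˡy⁻¹≡y⁻¹ → proj₁ (aperiodic l l<r 1≤l) (⁻¹-injective (trans (sym (iter-⁻¹ α l y)) aˡy⁻¹≡y⁻¹)))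
    , (λ aˡy⁻¹≡y⁻¹⁻¹ → proj₂ (aperiodic l l<r 1≤l) (⁻¹-injective (trans (sym (iter-⁻¹ α l y)) aˡy⁻¹≡y⁻¹⁻¹)))

  pairAperiodic⇒β-aperiodic : ∀ {r y} → Canonical y → PairAperiodic r y → ∀ l → l < r → 1 ≤ l → iter (β α) l y ≢ y
  pairAperiodic⇒β-aperiodic {y = y} y-canonical aperiodic l l<r 1≤l βˡy≡y
    with iter-β-fixed⇒BarEq α y y-canonical l βˡy≡y
  ... | inj₁ aˡy≡y = proj₁ (aperiodic l l<r 1≤l) aˡy≡y
  ... | inj₂ aˡy≡y⁻¹ = proj₂ (aperiodic l l<r 1≤l) aˡy≡y⁻¹

  β-aperiodic⇒pairAperiodic : ∀ {r y} → Canonical y → (∀ l → l < r → 1 ≤ l → iter (β α) l y ≢ y) → PairAperiodic r y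
  β-aperiodic⇒pairAperiodic {y = y} y-canonical aperiodic l l<r 1≤l =
      (λ aˡy≡y → aperiodic l l<r 1≤l (BarEq⇒iter-β-fixed α y y-canonical l (inj₁ aˡy≡y)))
    , (λ aˡy≡y⁻¹ → aperiodic l l<r 1≤l (BarEq⇒iter-β-fixed α y y-canonical l (inj₂ aˡy≡y⁻¹)))

  fixedOrInverted-⁻¹ : ∀ r y → FixedOrInverted r y → FixedOrInverted r (y ⁻¹)
  fixedOrInverted-⁻¹ r y (inj₁ (Sy , y≢y⁻¹ , aʳy≡y , aperiodic)) =
    inj₁ (S-⁻¹ Sy , nonInvolution-⁻¹ y y≢y⁻¹ , trans (iter-⁻¹ α r y) (cong _⁻¹ aʳy≡y) , pairAperiodic-⁻¹ aperiodic)
  fixedOrInverted-⁻¹ r y (inj₂ (Sy , y≢y⁻¹ , aʳy≡y⁻¹ , aperiodic)) =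
    inj₂ (S-⁻¹ Sy , nonInvolution-⁻¹ y y≢y⁻¹ , trans (iter-⁻¹ α r y) (cong _⁻¹ aʳy≡y⁻¹) , pairAperiodic-⁻¹ aperiodic)

  fixedOrInverted-nonInvolution : ∀ r y → FixedOrInverted r y → NonInvolution y
  fixedOrInverted-nonInvolution r y (inj₁ F) = proj₁ (proj₂ F)
  fixedOrInverted-nonInvolution r y (inj₂ I) = proj₁ (proj₂ I)

  module PairPart {k : ℕ} (σ : Permutation′ k) where
    open EquivariantInjections (N G) ε (β α) σ public

    periodic⇒fixedOrInverted : ∀ r y → Periodic PairReps r y → FixedOrInverted r y × Canonical y
    periodic⇒fixedOrInverted r y ((Sy , y²≢ε , y-canonical) , (_ , βʳy≡y , aperiodic))
      with iter-β-fixed⇒BarEq α y y-canonical r βʳy≡y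
    ... | inj₁ aʳy≡y =
      inj₁ (Sy , square≢ε⇒nonInvolution y y²≢ε , aʳy≡y , β-aperiodic⇒pairAperiodic y-canonical aperiodic) , y-canonical
    ... | inj₂ aʳy≡y⁻¹ =
      inj₂ (Sy , square≢ε⇒nonInvolution y y²≢ε , aʳy≡y⁻¹ , β-aperiodic⇒pairAperiodic y-canonical aperiodic) , y-canonical

    fixedOrInverted⇒periodic : ∀ r y → 1 ≤ r → FixedOrInverted r y × Canonical y → Periodic PairReps r y
    fixedOrInverted⇒periodic r y 1≤r (inj₁ (Sy , y≢y⁻¹ , aʳy≡y , aperiodic) , y-canonical) =
      (Sy , nonInvolution⇒square≢ε y y≢y⁻¹ , y-canonical) ,
      1≤r , BarEq⇒iter-β-fixed α y y-canonical r (inj₁ aʳy≡y) , pairAperiodic⇒β-aperiodic y-canonical aperiodic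
    fixedOrInverted⇒periodic r y 1≤r (inj₂ (Sy , y≢y⁻¹ , aʳy≡y⁻¹ , aperiodic) , y-canonical) =
      (Sy , nonInvolution⇒square≢ε y y≢y⁻¹ , y-canonical) ,
      1≤r , BarEq⇒iter-β-fixed α y y-canonical r (inj₂ aʳy≡y⁻¹) , pairAperiodic⇒β-aperiodic y-canonical aperiodic

    #periodic-PairReps : ∀ r → 1 ≤ r → #periodic pairReps? r + #periodic pairReps? r ≡ #Ftil G α S S? r + #Itil G α S S? r
    #periodic-PairReps r 1≤r = begin
      #periodic pairReps? r + #periodic pairReps? r
        ≡⟨ cong₂ _+_ as-canonical as-canonical ⟩
      count (fixedOrInverted? r ∩? below? _⁻¹) (allFin (N G)) + count (fixedOrInverted? r ∩? below? _⁻¹) (allFin (N G))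
        ≡⟨ count-involution-pairs _⁻¹ (fixedOrInverted? r) (fixedOrInverted-⁻¹ r) (λ y _ → ⁻¹-involutive y)
             (fixedOrInverted-nonInvolution r) ⟨
      count (fixedOrInverted? r) (allFin (N G))
        ≡⟨ count-fixedOrInverted r ⟩
      #Ftil G α S S? r + #Itil G α S S? r
        ∎
      where
      open ≡-Reasoning
      as-canonical : #periodic pairReps? r ≡ count (fixedOrInverted? r ∩? below? _⁻¹) (allFin (N G))
      as-canonical = count-cong (periodic? pairReps? r) (fixedOrInverted? r ∩? below? _⁻¹)
        (periodic⇒fixedOrInverted r _ , fixedOrInverted⇒periodic r _ 1≤r) (allFin (N G))

    count-PairPart : ℕ→ℚ (count (isEmbedding? U? pairReps?) (allVec (N G) k)) ≡ ProdX G α S S? k σ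
    count-PairPart = begin
      ℕ→ℚ (count (isEmbedding? U? pairReps?) (allVec (N G) k))
        ≡⟨ count-embeddings U? pairReps? (λ _ _ → _) β-closed-PairReps β-injective-PairReps ⟩
      cycleProduct k (#periodic pairReps?) (#cycles U?)
        ≡⟨ prodℚ-cong {k} refl (λ r-1 _ → prodℚ-cong (#cycles-U (suc r-1)) (λ t _ →
             cong (ℚ._- ℕ→ℚ (suc r-1 * t)) (halved (suc r-1) (s≤s z≤n)))) ⟩
      ProdX G α S S? k σ
        ∎
      where
      open ≡-Reasoning
      halved : ∀ r → 1 ≤ r → ℕ→ℚ (#periodic pairReps? r) ≡ (ℤ.+ (#Ftil G α S S? r + #Itil G α S S? r)) ℚ./ 2
      halved r 1≤r = trans (sym (half (#periodic pairReps? r))) (cong (λ n → (ℤ.+ n) ℚ./ 2) (#periodic-PairReps r 1≤r))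

  module InvolutionPart {n : ℕ} (τ : Permutation′ n) where
    open EquivariantInjections (N G) ε a τ public

    #periodic-Involutions : ∀ r → 1 ≤ r → #periodic involutions? r ≡ #Fotil G α S S? r
    #periodic-Involutions r 1≤r = count-cong (periodic? involutions? r) (Fotil? G α S S? r)
      ( (λ ((Sy , y⁻¹≡y , y≢ε) , (_ , aʳy≡y , aperiodic)) → Sy , y⁻¹≡y , y≢ε , aʳy≡y , aperiodic)
      , (λ (Sy , y⁻¹≡y , y≢ε , aʳy≡y , aperiodic) → (Sy , y⁻¹≡y , y≢ε) , (1≤r , aʳy≡y , aperiodic)))
      (allFin (N G))

    count-InvolutionPart : ℕ→ℚ (count (isEmbedding? U? involutions?) (allVec (N G) n)) ≡ ProdY G α S S? n τ
    count-InvolutionPart = begin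
      ℕ→ℚ (count (isEmbedding? U? involutions?) (allVec (N G) n))
        ≡⟨ count-embeddings U? involutions? (λ _ _ → _) a-closed-Involutions (λ x y _ _ → a.injective) ⟩
      cycleProduct n (#periodic involutions?) (#cycles U?)
        ≡⟨ cycleProduct-cong n {#periodic involutions?} {#Fotil G α S S?} {#cycles U?} {j τ}
             (λ q → #periodic-Involutions (suc q) (s≤s z≤n)) (#cycles-U ∘ suc) ⟩
      ProdY G α S S? n τ
        ∎
      where open ≡-Reasoning

  module _ (m k : ℕ) (σ : Permutation′ k) (τ : Permutation′ (m ∸ 2 * k)) where

    private
      module X = PairPart σ
      module Y = InvolutionPart τ

      distinct⇒injective : ∀ {n} (v : Vec A n) → (∀ i i′ → i ≢ i′ → ¬ BarEq G (lookup v i) (lookup v i′))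
        → ∀ i i′ → lookup v i ≡ lookup v i′ → i ≡ i′
      distinct⇒injective v distinct i i′ vi≡vi′ with i FinP.≟ i′
      ... | yes i≡i′ = i≡i′
      ... | no i≢i′ = ⊥-elim (distinct i i′ i≢i′ (inj₁ vi≡vi′))

      self-inverse-BarEq⇒≡ : ∀ {x y} → y ⁻¹ ≡ y → BarEq G x y → x ≡ y
      self-inverse-BarEq⇒≡ _ (inj₁ x≡y) = x≡y
      self-inverse-BarEq⇒≡ y⁻¹≡y (inj₂ x≡y⁻¹) = trans x≡y⁻¹ y⁻¹≡y

    fixed⇒embeddings : ∀ t → InG G α S S? m k t × Fixed G α S S? m k σ τ t
      → X.IsEmbedding U PairReps (proj₁ t) × Y.IsEmbedding U Involutions (proj₂ t)
    fixed⇒embeddings (x , y) ((x-canonical , x-pairs , y-involutions , x-distinct , y-distinct , _) , (x-fixed , y-fixed)) =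
      record
        { into        = λ i _ → proj₁ (x-pairs i) , proj₂ (x-pairs i) , x-canonical i
        ; outside     = λ i ¬U → ⊥-elim (¬U _)
        ; equivariant = λ i _ → BarEq⇒rep≡ (a (lookup x i)) (lookup x (σ ⟨$⟩ʳ i)) (x-canonical (σ ⟨$⟩ʳ i))
                                  (subst (λ z → BarEq G (a (lookup x z)) (lookup x (σ ⟨$⟩ʳ i))) (Permutation.inverseˡ σ)
                                         (x-fixed (σ ⟨$⟩ʳ i)))
        ; injective   = λ i i′ _ _ → distinct⇒injective x x-distinct i i′
        } ,
      record
        { into        = λ j _ → y-involutions j
        ; outside     = λ j ¬U → ⊥-elim (¬U _)
        ; equivariant = λ j _ → self-inverse-BarEq⇒≡ (proj₁ (proj₂ (y-involutions (τ ⟨$⟩ʳ j))))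
                                  (subst (λ z → BarEq G (a (lookup y z)) (lookup y (τ ⟨$⟩ʳ j))) (Permutation.inverseˡ τ)
                                         (y-fixed (τ ⟨$⟩ʳ j)))
        ; injective   = λ j j′ _ _ → distinct⇒injective y y-distinct j j′
        }

    embeddings⇒fixed : ∀ t → X.IsEmbedding U PairReps (proj₁ t) × Y.IsEmbedding U Involutions (proj₂ t)
      → InG G α S S? m k t × Fixed G α S S? m k σ τ t
    embeddings⇒fixed (x , y) (x-emb , y-emb) =
      ( (λ i → proj₂ (proj₂ (x-pair i)))
      , (λ i → proj₁ (x-pair i) , proj₁ (proj₂ (x-pair i)))
      , (λ j → y-inv j)
      , (λ i i′ i≢i′ bar → i≢i′ (X.IsEmbedding.injective x-emb i i′ _ _
                             (canonical-BarEq⇒≡ _ _ (proj₂ (proj₂ (x-pair i))) (proj₂ (proj₂ (x-pair i′))) bar)))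
      , (λ j j′ j≢j′ bar → j≢j′ (Y.IsEmbedding.injective y-emb j j′ _ _ (self-inverse-BarEq⇒≡ (proj₁ (proj₂ (y-inv j′))) bar)))
      , (λ i j bar → proj₁ (proj₂ (x-pair i))
          (subst (λ z → z ∙ z ≡ ε) (sym (self-inverse-BarEq⇒≡ (proj₁ (proj₂ (y-inv j))) bar))
                 (self-inverse⇒square≡ε (lookup y j) (proj₁ (proj₂ (y-inv j))))))
      ) ,
      ( (λ i → subst (BarEq G (a (lookup x (σ ⟨$⟩ˡ i))))
                     (trans (X.IsEmbedding.equivariant x-emb (σ ⟨$⟩ˡ i) _) (cong (lookup x) (Permutation.inverseʳ σ)))
                     (rep-BarEq (a (lookup x (σ ⟨$⟩ˡ i)))))
      , (λ j → inj₁ (trans (Y.IsEmbedding.equivariant y-emb (τ ⟨$⟩ˡ j) _) (cong (lookup y) (Permutation.inverseʳ τ))))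
      )
      where
      x-pair : ∀ i → PairReps (lookup x i)
      x-pair i = X.IsEmbedding.into x-emb i _
      y-inv : ∀ j → Involutions (lookup y j)
      y-inv j = Y.IsEmbedding.into y-emb j _

    #Fix-product : ℕ→ℚ (#Fix G α S S? m k σ τ) ≡ ProdX G α S S? k σ ℚ.* ProdY G α S S? (m ∸ 2 * k) τ
    #Fix-product = begin
      ℕ→ℚ (#Fix G α S S? m k σ τ)
        ≡⟨ cong ℕ→ℚ (count-cong (λ t → InG? G α S S? m k t ×-dec Fixed? G α S S? m k σ τ t) embeddings?
                                 (fixed⇒embeddings _ , embeddings⇒fixed _) pairs) ⟩
      ℕ→ℚ (count embeddings? pairs)
        ≡⟨ count-cartesianProduct (X.isEmbedding? U? pairReps?) (λ _ → Y.isEmbedding? U? involutions?)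
             (allVec (N G) k) (allVec (N G) (m ∸ 2 * k)) (ProdY G α S S? (m ∸ 2 * k) τ) (λ _ _ → Y.count-InvolutionPart) ⟩
      ℕ→ℚ (count (X.isEmbedding? U? pairReps?) (allVec (N G) k)) ℚ.* ProdY G α S S? (m ∸ 2 * k) τ
        ≡⟨ cong (ℚ._* ProdY G α S S? (m ∸ 2 * k) τ) X.count-PairPart ⟩
      ProdX G α S S? k σ ℚ.* ProdY G α S S? (m ∸ 2 * k) τ
        ∎
      where
      open ≡-Reasoning
      pairs = cartesianProduct (allVec (N G) k) (allVec (N G) (m ∸ 2 * k))
      embeddings? : Decidable (λ t → X.IsEmbedding U PairReps (proj₁ t) × Y.IsEmbedding U Involutions (proj₂ t))
      embeddings? t = X.isEmbedding? U? pairReps? (proj₁ t) ×-dec Y.isEmbedding? U? involutions? (proj₂ t)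

ProdY-empty : (G : FinGroup) (α : Aut G) (S : Pred (Fin (N G)) 0ℓ) (S? : Decidable S)
  → ∀ n (τ : Permutation′ n) → n ≡ 0 → ProdY G α S S? n τ ≡ ℚ.1ℚ
ProdY-empty G α S S? zero τ refl = refl

lemma3p2 : (G : FinGroup) (m k : ℕ) → 1 ≤ m → 2 * k ≤ m
  → (α : Aut G) (σ : Permutation′ k) (τ : Permutation′ (m ∸ 2 * k))
  → (S : Pred (Fin (N G)) 0ℓ) (S? : Decidable S) → IsSubgroup G S → Stable G α S
  → (ℕ→ℚ (#Fix G α S S? m k σ τ) ≡ ProdX G α S S? k σ ℚ.* ProdY G α S S? (m ∸ 2 * k) τ)
    × (¬ (2 ∣ N G)
       → (m ≡ 2 * k → ℕ→ℚ (#Fix G α S S? m k σ τ) ≡ ProdX G α S S? k σ)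
         × (m ≢ 2 * k → #Fix G α S S? m k σ τ ≡ 0))
lemma3p2 G m k _ 2k≤m α σ τ S S? S-subgroup S-stable = product , λ odd → balanced , unbalanced odd
  where
  open FixedTuples G α S S? S-subgroup S-stable using (#Fix-product)
  product = #Fix-product m k σ τ
  balanced : m ≡ 2 * k → ℕ→ℚ (#Fix G α S S? m k σ τ) ≡ ProdX G α S S? k σ
  balanced m≡2k = trans product (trans
    (cong (ProdX G α S S? k σ ℚ.*_) (ProdY-empty G α S S? (m ∸ 2 * k) τ (trans (cong (_∸ 2 * k) m≡2k) (ℕP.n∸n≡0 (2 * k)))))
    (ℚP.*-identityʳ (ProdX G α S S? k σ)))
  unbalanced : ¬ (2 ∣ N G) → m ≢ 2 * k → #Fix G α S S? m k σ τ ≡ 0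
  unbalanced odd m≢2k = count-none (λ t → InG? G α S S? m k t ×-dec Fixed? G α S S? m k σ τ t)
    (cartesianProduct (allVec (N G) k) (allVec (N G) (m ∸ 2 * k)))
    λ (_ , y) ((_ , _ , y-involutions , _) , _) → let (_ , y⁻¹≡y , y≢e) = y-involutions j₀ in
      odd (involution⇒even-order G _ y⁻¹≡y y≢e)
    where
    j₀ : Fin (m ∸ 2 * k)
    j₀ = fromℕ< (ℕP.m<n⇒0<n∸m (ℕP.≤∧≢⇒< 2k≤m (m≢2k ∘ sym)))
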